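{- If $\mathcal M$ is a matroid of co-rank $3$ (i.e. its dual $\mathcal M^*$ has rank $3$), then the combinatorial derived matroid $\delta\mathcal M$ is an adjoint of $\mathcal M$.
   Context: Let $E$ be the ground set, $n=|E|$, $d=\mathrm{rank}(\mathcal M)$, $\mathcal C(\mathcal M)$ the set of circuits. Define $\mathcal S(\mathcal M)=\{\mathcal S\subseteq\mathcal C(\mathcal M): |\mathcal S|\le (n-d)-r_{\mathcal M^*}(\bigcap_{C\in\mathcal S}(E\setminus C))\}$ (empty intersection $=E$). For a collection $\mathfrak A$ of subsets of $\mathcal C(\mathcal M)$ let $\epsilon(\mathfrak A)=\mathfrak A\cup\{(\mathcal A_1\cup\mathcal A_2)\setminus\{C\}: \mathcal A_1,\mathcal A_2\in\mathfrak A,\ \mathcal A_1\cap\mathcal A_2\notin\mathfrak A,\ C\in\mathcal A_1\cap\mathcal A_2\}$ and $\uparrow\mathfrak A=\{\mathcal A\subseteq\mathcal C(\mathcal M):\exists\mathcal A'\in\mathfrak A,\ \mathcal A'\subseteq\mathcal A\}$. Set $\mathfrak A_0=\mathfrak A$, $\mathfrak A_{i+1}=\uparrow\epsilon(\mathfrak A_i)$ and $D(\mathfrak A)=\bigcup_{i\ge0}\mathfrak A_i$. It is known that if $\emptyset\notin\mathfrak A$ then $D(\mathfrak A)$ is the family of dependent sets of a matroid on $\mathcal C(\mathcal M)$. The combinatorial derived matroid $\delta\mathcal M$ is the matroid on $\mathcal C(\mathcal M)$ whose family of dependent sets is $D(2^{\mathcal C(\mathcal M)}\setminus\mathcal S(\mathcal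 M))$. Adjoint: $\mathcal L^*$ is the lattice of flats of $\mathcal M^*$, $(\mathcal L^*)^{opp}$ its order dual (rank function $(n-d)-r_{\mathcal M^*}$), whose atoms are the hyperplanes $E\setminus C$ of $\mathcal M^*$, $C\in\mathcal C(\mathcal M)$. A matroid $\mathcal N$ on $\mathcal C(\mathcal M)$ with lattice of flats $\mathcal L(\mathcal N)$ is an adjoint of $\mathcal M$ if the map $E\setminus C\mapsto\mathrm{cl}_{\mathcal N}(\{C\})$ is a bijection from the atoms of $(\mathcal L^*)^{opp}$ onto the atoms of $\mathcal L(\mathcal N)$ and extends to a rank-preserving order embedding $f:(\mathcal L^*)^{opp}\to\mathcal L(\mathcal N)$ ($x\le y\iff f(x)\le f(y)$, ranks preserved). -}

module Defs where

open import Data.Nat using (ℕ; _≤_; _<_; _∸_; _+_)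
open import Data.Bool using (Bool; if_then_else_)
open import Data.Fin using (Fin)
open import Data.Fin.Subset
  using (Subset; _∈_; _∉_; _⊆_; _⊂_; ∁; _∩_; _∪_; _─_; ⁅_⁆; ∣_∣; ⋂; ⊤; ⊥)
open import Data.Vec using (lookup)
open import Data.List using (map; allFin)
open import Data.Product using (Σ; ∃; _×_; ∃-syntax)
open import Data.Sum using (_⊎_)
open import Relation.Nullary using (¬_)
open import Relation.Binary.PropositionalEquality using (_≡_)
open import Function.Bundles using (_⇔_)

record Matroid (n : ℕ) : Set where
  field
    rank      : Subset n → ℕ
    rank-≤    : ∀ X → rank X ≤ ∣ X ∣
    rank-mono : ∀ X Y → X ⊆ Y → rank X ≤ rank Y
    rank-sub  : ∀ X Y → rank (X ∪ Y) + rank (X ∩ Y) ≤ rank X + rank Y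

module _ {n : ℕ} (M : Matroid n) where
  open Matroid M

  Independent : Subset n → Set
  Independent X = rank X ≡ ∣ X ∣

  Dependent : Subset n → Set
  Dependent X = ¬ Independent X

  IsCircuit : Subset n → Set
  IsCircuit C = Dependent C × (∀ D → D ⊂ C → Independent D)

  dualRank : Subset n → ℕ
  dualRank X = (∣ X ∣ + rank (∁ X)) ∸ rank ⊤

  corank : ℕ
  corank = dualRank ⊤

  IsDualFlat : Subset n → Set
  IsDualFlat F = ∀ e → e ∉ F → dualRank F < dualRank (F ∪ ⁅ e ⁆)

  oppRank : Subset n → ℕ
  oppRank F = corank ∸ dualRank F

  -- A bijective enumeration circ : Fin m → C(M) of the circuits of M.
  -- Collections of circuits are then subsets of Fin m.
  record CircuitEnumeration (m : ℕ) : Set where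
    field
      circ          : Fin m → Subset n
      circ-circuit  : ∀ i → IsCircuit (circ i)
      circ-injective : ∀ i j → circ i ≡ circ j → i ≡ j
      circ-onto     : ∀ C → IsCircuit C → ∃[ i ] circ i ≡ C

  module _ {m : ℕ} (en : CircuitEnumeration m) where
    open CircuitEnumeration en

    -- ⋂_{C ∈ 𝒮} (E \ C), with the empty intersection being E
    interCompl : Subset m → Subset n
    interCompl 𝒮 = ⋂ (map (λ i → if lookup 𝒮 i then ∁ (circ i) else ⊤) (allFin m))

    InS : Subset m → Set
    InS 𝒮 = ∣ 𝒮 ∣ ≤ corank ∸ dualRank (interCompl 𝒮)

Family : ℕ → Set₁
Family m = Subset m → Set

ε : ∀ {m} → Family m → Family m
ε {m} 𝔄 B = 𝔄 B ⊎
  (Σ (Subset m) λ A₁ → Σ (Subset m) λ A₂ → Σ (Fin m) λ C →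
     𝔄 A₁ × 𝔄 A₂ × ¬ 𝔄 (A₁ ∩ A₂) × C ∈ (A₁ ∩ A₂) ×
     B ≡ (A₁ ∪ A₂) ─ ⁅ C ⁆)

up : ∀ {m} → Family m → Family m
up {m} 𝔄 A = Σ (Subset m) λ A′ → 𝔄 A′ × A′ ⊆ A

stage : ∀ {m} → Family m → ℕ → Family m
stage 𝔄 ℕ.zero    = 𝔄
stage 𝔄 (ℕ.suc i) = up (ε (stage 𝔄 i))

D : ∀ {m} → Family m → Family m
D 𝔄 A = ∃[ i ] stage 𝔄 i A

derivedDependent : ∀ {n} (M : Matroid n) {m} → CircuitEnumeration M m → Family m
derivedDependent M en = D (λ 𝒮 → ¬ InS M en 𝒮)

module _ {m : ℕ} (Dep : Family m) where

  IndepN : Subset m → Set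
  IndepN X = ¬ Dep X

  HasRankN : Subset m → ℕ → Set
  HasRankN X k = (Σ (Subset m) λ I → I ⊆ X × IndepN I × ∣ I ∣ ≡ k)
               × (∀ I → I ⊆ X → IndepN I → ∣ I ∣ ≤ k)

  InClN : Subset m → Fin m → Set
  InClN X c = ∃[ k ] (HasRankN X k × HasRankN (X ∪ ⁅ c ⁆) k)

  IsFlatN : Subset m → Set
  IsFlatN X = ∀ c → InClN X c → c ∈ X

  EqCl : Subset m → Subset m → Set
  EqCl X Y = ∀ c → (c ∈ X ⇔ InClN Y c)

IsAdjoint : ∀ {n} (M : Matroid n) {m} (en : CircuitEnumeration M m) → Family m → Set
IsAdjoint {n} M {m} en Dep =
  -- the atom map E \ C ↦ cl_N({C}) lands in the atoms of L(N) ...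
  (∀ i → Σ (Subset m) λ X → EqCl Dep X ⁅ i ⁆ × IsFlatN Dep X × HasRankN Dep X 1)
  × (∀ i j → (∀ c → InClN Dep ⁅ i ⁆ c ⇔ InClN Dep ⁅ j ⁆ c) → ∁ (circ i) ≡ ∁ (circ j))
  × (∀ X → IsFlatN Dep X → HasRankN Dep X 1 → ∃[ i ] EqCl Dep X ⁅ i ⁆)
  -- ... and extends to a rank-preserving order embedding (L*)^opp → L(N)
  × (Σ (Subset n → Subset m) λ f →
        (∀ i → EqCl Dep (f (∁ (circ i))) ⁅ i ⁆)
      × (∀ F → IsDualFlat M F → IsFlatN Dep (f F))
      × (∀ F G → IsDualFlat M F → IsDualFlat M G → (G ⊆ F ⇔ f F ⊆ f G))
      × (∀ F → IsDualFlat M F → HasRankN Dep (f F) (oppRank M F)))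
  where open CircuitEnumeration en

-- The complements H_C = E ∖ C of the circuits are exactly the hyperplanes of M*, which has
-- rank 3, and a collection 𝒮 of circuits lies in 𝒮(M) iff |𝒮| + r*(⋂_{C∈𝒮} H_C) ≤ 3.  Two
-- distinct hyperplanes meet in rank at most 1, so all collections of at most two circuits are
-- in 𝒮(M), none of four are, and a triple is outside exactly when its hyperplanes share a
-- point.  This family of non-members is already upward closed and closed under the
-- elimination step ε, so D adds nothing and the independent sets of δM are those of 𝒮(M).
-- The embedding sends a flat F of M* to the circuits C with F ⊆ H_C; a case analysis on
-- r*(F) ∈ {0,1,2,3} shows that this is a flat of δM of rank 3 − r*(F).

module Submission where

open import Defs
open import Data.Nat using (ℕ; zero; suc; _+_; _∸_; _≤_; _<_; z≤n; s≤s; _≤?_)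
open import Data.Nat.Properties
open import Data.Bool using (true; false; if_then_else_)
open import Data.Fin using (Fin)
import Data.Fin.Properties as Fin
open import Data.Fin.Subset
open import Data.Fin.Subset.Properties
open import Data.Vec using ([]; _∷_; here; there; tabulate; lookup)
open import Data.List using (List; []; _∷_; map; allFin)
open import Data.List.Membership.Propositional.Properties using (∈-map⁺; ∈-map⁻; ∈-allFin)
open import Data.List.Membership.Propositional using () renaming (_∈_ to _∈ₗ_)
open import Data.List.Relation.Unary.Any using (here; there)
open import Data.Vec.Properties using (lookup∘tabulate; []=⇒lookup; lookup⇒[]=)
open import Data.Product using (∃; _×_; _,_; proj₁; proj₂; ∃-syntax)
open import Data.Sum using (inj₁; inj₂)
open import Relation.Nullary using (¬_; Dec; yes; no; does; contradiction; ¬?; _×-dec_)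
open import Relation.Nullary.Decidable using (decidable-stable; dec-true)
open import Relation.Unary using (Pred; Decidable)
open import Level using (0ℓ)
open import Relation.Binary.PropositionalEquality
open import Function.Bundles using (_⇔_; mk⇔; Equivalence)
open import Function using (_∘′_; case_of_)
import Algebra.Lattice.Properties.BooleanAlgebra as BooleanAlgebraProperties
open import Algebra.Properties.CommutativeSemigroup +-commutativeSemigroup using (interchange)

private variable
  n : ℕ
  p q s : Subset n
  x : Fin n

x∈p─q⇒x∉q : ∀ (p q : Subset n) → x ∈ p ─ q → x ∉ q
x∈p─q⇒x∉q (_ ∷ p) (true ∷ q) (there x∈) (there x∈q) = x∈p─q⇒x∉q p q x∈ x∈q
x∈p─q⇒x∉q (_ ∷ p) (false ∷ q) (there x∈) (there x∈q) = x∈p─q⇒x∉q p q x∈ x∈q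

∣p∪q∣+∣p∩q∣≡∣p∣+∣q∣ : ∀ (p q : Subset n) → ∣ p ∪ q ∣ + ∣ p ∩ q ∣ ≡ ∣ p ∣ + ∣ q ∣
∣p∪q∣+∣p∩q∣≡∣p∣+∣q∣ [] [] = refl
∣p∪q∣+∣p∩q∣≡∣p∣+∣q∣ (true ∷ p) (true ∷ q) =
  cong suc (trans (+-suc _ _) (trans (cong suc (∣p∪q∣+∣p∩q∣≡∣p∣+∣q∣ p q)) (sym (+-suc _ _))))
∣p∪q∣+∣p∩q∣≡∣p∣+∣q∣ (true ∷ p) (false ∷ q) = cong suc (∣p∪q∣+∣p∩q∣≡∣p∣+∣q∣ p q)
∣p∪q∣+∣p∩q∣≡∣p∣+∣q∣ (false ∷ p) (true ∷ q) = trans (cong suc (∣p∪q∣+∣p∩q∣≡∣p∣+∣q∣ p q)) (sym (+-suc _ _))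
∣p∪q∣+∣p∩q∣≡∣p∣+∣q∣ (false ∷ p) (false ∷ q) = ∣p∪q∣+∣p∩q∣≡∣p∣+∣q∣ p q

∣p─q∣+∣p∩q∣≡∣p∣ : ∀ (p q : Subset n) → ∣ p ─ q ∣ + ∣ p ∩ q ∣ ≡ ∣ p ∣
∣p─q∣+∣p∩q∣≡∣p∣ [] [] = refl
∣p─q∣+∣p∩q∣≡∣p∣ (true ∷ p) (true ∷ q) = trans (+-suc _ _) (cong suc (∣p─q∣+∣p∩q∣≡∣p∣ p q))
∣p─q∣+∣p∩q∣≡∣p∣ (true ∷ p) (false ∷ q) = cong suc (∣p─q∣+∣p∩q∣≡∣p∣ p q)
∣p─q∣+∣p∩q∣≡∣p∣ (false ∷ p) (true ∷ q) = ∣p─q∣+∣p∩q∣≡∣p∣ p q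
∣p─q∣+∣p∩q∣≡∣p∣ (false ∷ p) (false ∷ q) = ∣p─q∣+∣p∩q∣≡∣p∣ p q

q⊆p⇒∣p─q∣+∣q∣≡∣p∣ : ∀ (p q : Subset n) → q ⊆ p → ∣ p ─ q ∣ + ∣ q ∣ ≡ ∣ p ∣
q⊆p⇒∣p─q∣+∣q∣≡∣p∣ p q q⊆p =
  trans (cong (λ s → ∣ p ─ q ∣ + ∣ s ∣) (sym p∩q≡q)) (∣p─q∣+∣p∩q∣≡∣p∣ p q)
  where
  p∩q≡q : p ∩ q ≡ q
  p∩q≡q = ⊆-antisym (p∩q⊆q p q) (λ x∈q → x∈p∩q⁺ (q⊆p x∈q , x∈q))

∣p∣+∣∁p∣≡n : ∀ (p : Subset n) → ∣ p ∣ + ∣ ∁ p ∣ ≡ n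
∣p∣+∣∁p∣≡n p = trans (cong (∣ p ∣ +_) (∣∁p∣≡n∸∣p∣ p)) (m+[n∸m]≡n (∣p∣≤n p))

∪-least : p ⊆ s → q ⊆ s → p ∪ q ⊆ s
∪-least {p = p} {q = q} p⊆s q⊆s x∈ with x∈p∪q⁻ p q x∈
... | inj₁ x∈p = p⊆s x∈p
... | inj₂ x∈q = q⊆s x∈q

x∈p⇒⁅x⁆⊆p : x ∈ p → ⁅ x ⁆ ⊆ p
x∈p⇒⁅x⁆⊆p {x = x} x∈p y∈ rewrite x∈⁅y⁆⇒x≡y x y∈ = x∈p

x∉p⇒∣p∪⁅x⁆∣≡1+∣p∣ : ∀ (p : Subset n) → x ∉ p → ∣ p ∪ ⁅ x ⁆ ∣ ≡ suc ∣ p ∣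
x∉p⇒∣p∪⁅x⁆∣≡1+∣p∣ {n = n} {x = x} p x∉p = begin
  ∣ p ∪ ⁅ x ⁆ ∣                       ≡⟨ sym (+-identityʳ _) ⟩
  ∣ p ∪ ⁅ x ⁆ ∣ + 0                   ≡⟨ cong (∣ p ∪ ⁅ x ⁆ ∣ +_) ∣p∩⁅x⁆∣≡0 ⟨
  ∣ p ∪ ⁅ x ⁆ ∣ + ∣ p ∩ ⁅ x ⁆ ∣       ≡⟨ ∣p∪q∣+∣p∩q∣≡∣p∣+∣q∣ p ⁅ x ⁆ ⟩
  ∣ p ∣ + ∣ ⁅ x ⁆ ∣                   ≡⟨ cong (∣ p ∣ +_) (∣⁅x⁆∣≡1 x) ⟩
  ∣ p ∣ + 1                           ≡⟨ +-comm ∣ p ∣ 1 ⟩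
  suc ∣ p ∣                           ∎
  where
  open ≡-Reasoning
  ∣p∩⁅x⁆∣≡0 : ∣ p ∩ ⁅ x ⁆ ∣ ≡ 0
  ∣p∩⁅x⁆∣≡0 = trans (cong ∣_∣ (Empty-unique disjoint)) (∣⊥∣≡0 n)
    where
    disjoint : Empty (p ∩ ⁅ x ⁆)
    disjoint (y , y∈) with x∈p∩q⁻ p ⁅ x ⁆ y∈
    ... | y∈p , y∈⁅x⁆ = x∉p (subst (_∈ p) (x∈⁅y⁆⇒x≡y x y∈⁅x⁆) y∈p)

x≢y⇒∣⁅x⁆∪⁅y⁆∣≡2 : ∀ {x y : Fin n} → x ≢ y → ∣ ⁅ x ⁆ ∪ ⁅ y ⁆ ∣ ≡ 2
x≢y⇒∣⁅x⁆∪⁅y⁆∣≡2 {x = x} {y} x≢y =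
  trans (x∉p⇒∣p∪⁅x⁆∣≡1+∣p∣ ⁅ x ⁆ (x≢y ∘′ sym ∘′ x∈⁅y⁆⇒x≡y x)) (cong suc (∣⁅x⁆∣≡1 x))

x∈p⇒∣p∣≡1+∣p-x∣ : ∀ (p : Subset n) → x ∈ p → ∣ p ∣ ≡ suc ∣ p - x ∣
x∈p⇒∣p∣≡1+∣p-x∣ {x = x} p x∈p =
  trans (cong ∣_∣ p≡p-x∪⁅x⁆) (x∉p⇒∣p∪⁅x⁆∣≡1+∣p∣ (p - x) (λ x∈ → x∈p─q⇒x∉q p ⁅ x ⁆ x∈ (x∈⁅x⁆ x)))
  where
  p⊆p-x∪⁅x⁆ : p ⊆ (p - x) ∪ ⁅ x ⁆
  p⊆p-x∪⁅x⁆ {y} y∈p with y Fin.≟ x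
  ... | yes refl = x∈p∪q⁺ (inj₂ (x∈⁅x⁆ x))
  ... | no y≢x = x∈p∪q⁺ (inj₁ (x∈p∧x≢y⇒x∈p-y y∈p y≢x))
  p≡p-x∪⁅x⁆ : p ≡ (p - x) ∪ ⁅ x ⁆
  p≡p-x∪⁅x⁆ = ⊆-antisym p⊆p-x∪⁅x⁆ (∪-least (p─q⊆p p ⁅ x ⁆) (x∈p⇒⁅x⁆⊆p x∈p))

nonempty : ∀ (p : Subset n) → 1 ≤ ∣ p ∣ → Nonempty p
nonempty {n = n} p 1≤∣p∣ with nonempty? p
... | yes ne = ne
... | no ¬ne = contradiction (trans (cong ∣_∣ (Empty-unique ¬ne)) (∣⊥∣≡0 n)) (>⇒≢ 1≤∣p∣)

⊈⇒∃∈∉ : p ⊈ q → ∃[ x ] (x ∈ p × x ∉ q)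
⊈⇒∃∈∉ {p = p} {q = q} p⊈q with Fin.any? (λ x → (x ∈? p) ×-dec ¬? (x ∈? q))
... | yes witness = witness
... | no ¬witness = contradiction (λ {x} x∈p → decidable-stable (x ∈? q) (λ x∉q → ¬witness (x , x∈p , x∉q))) p⊈q

⊆∧∣q∣≤∣p∣⇒≡ : p ⊆ q → ∣ q ∣ ≤ ∣ p ∣ → p ≡ q
⊆∧∣q∣≤∣p∣⇒≡ {p = p} {q = q} p⊆q ∣q∣≤∣p∣ with q ⊆? p
... | yes q⊆p = ⊆-antisym p⊆q q⊆p
... | no q⊈p = contradiction (p⊂q⇒∣p∣<∣q∣ (p⊆q , ⊈⇒∃∈∉ q⊈p)) (≤⇒≯ ∣q∣≤∣p∣)

x∈⋂⁻ : ∀ (ps : List (Subset n)) → x ∈ ⋂ ps → p ∈ₗ ps → x ∈ p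
x∈⋂⁻ (q ∷ ps) x∈ (here refl) = proj₁ (x∈p∩q⁻ q (⋂ ps) x∈)
x∈⋂⁻ (q ∷ ps) x∈ (there p∈ps) = x∈⋂⁻ ps (proj₂ (x∈p∩q⁻ q (⋂ ps) x∈)) p∈ps

x∈⋂⁺ : ∀ (ps : List (Subset n)) → (∀ {p} → p ∈ₗ ps → x ∈ p) → x ∈ ⋂ ps
x∈⋂⁺ [] _ = ∈⊤
x∈⋂⁺ (q ∷ ps) x∈all = x∈p∩q⁺ (x∈all (here refl) , x∈⋂⁺ ps (x∈all ∘′ there))

subsetOf : {P : Pred (Fin n) 0ℓ} → Decidable P → Subset n
subsetOf P? = tabulate (λ x → does (P? x))

module _ {P : Pred (Fin n) 0ℓ} (P? : Decidable P) where

  ∈subsetOf⁻ : x ∈ subsetOf P? → P x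
  ∈subsetOf⁻ {x = x} x∈ with P? x | trans (sym (lookup∘tabulate (λ x → does (P? x)) x)) ([]=⇒lookup x∈)
  ... | yes Px | _ = Px

  ∈subsetOf⁺ : P x → x ∈ subsetOf P?
  ∈subsetOf⁺ {x = x} Px = lookup⇒[]= x _ (trans (lookup∘tabulate (λ x → does (P? x)) x) (dec-true (P? x) Px))

module MatroidProperties {n : ℕ} (M : Matroid n) where
  open Matroid M

  private variable
    X Y A B F G H : Subset n
    e : Fin n

  mono : X ⊆ Y → rank X ≤ rank Y
  mono {X} {Y} = rank-mono X Y

  rank≤rank⊤ : ∀ X → rank X ≤ rank ⊤
  rank≤rank⊤ X = mono ⊆⊤

  rank-⊥ : rank ⊥ ≡ 0
  rank-⊥ = n≤0⇒n≡0 (subst (rank ⊥ ≤_) (∣⊥∣≡0 n) (rank-≤ ⊥))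

  rank-∪ : ∀ X Y → rank (X ∪ Y) ≤ rank X + rank Y
  rank-∪ X Y = ≤-trans (m≤m+n _ _) (rank-sub X Y)

  rank-∪⁅⁆ : ∀ X e → rank (X ∪ ⁅ e ⁆) ≤ suc (rank X)
  rank-∪⁅⁆ X e = begin
    rank (X ∪ ⁅ e ⁆)      ≤⟨ rank-∪ X ⁅ e ⁆ ⟩
    rank X + rank ⁅ e ⁆   ≤⟨ +-monoʳ-≤ (rank X) (subst (rank ⁅ e ⁆ ≤_) (∣⁅x⁆∣≡1 e) (rank-≤ ⁅ e ⁆)) ⟩
    rank X + 1            ≡⟨ +-comm (rank X) 1 ⟩
    suc (rank X)          ∎
    where open ≤-Reasoning

  Flat : Subset n → Set
  Flat F = ∀ e → e ∉ F → rank F < rank (F ∪ ⁅ e ⁆)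

  Hyperplane : Subset n → Set
  Hyperplane H = Flat H × suc (rank H) ≡ rank ⊤

  independent-⊆ : Independent M Y → X ⊆ Y → Independent M X
  independent-⊆ {Y} {X} indY X⊆Y = ≤-antisym (rank-≤ X) (+-cancelʳ-≤ ∣ Y ─ X ∣ _ _ (begin
    ∣ X ∣ + ∣ Y ─ X ∣         ≡⟨ trans (+-comm ∣ X ∣ _) (q⊆p⇒∣p─q∣+∣q∣≡∣p∣ Y X X⊆Y) ⟩
    ∣ Y ∣                     ≡⟨ indY ⟨
    rank Y                    ≤⟨ mono Y⊆X∪Y─X ⟩
    rank (X ∪ (Y ─ X))        ≤⟨ rank-∪ X (Y ─ X) ⟩
    rank X + rank (Y ─ X)     ≤⟨ +-monoʳ-≤ (rank X) (rank-≤ (Y ─ X)) ⟩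
    rank X + ∣ Y ─ X ∣        ∎))
    where
    open ≤-Reasoning
    Y⊆X∪Y─X : Y ⊆ X ∪ (Y ─ X)
    Y⊆X∪Y─X {x} x∈Y with x ∈? X
    ... | yes x∈X = x∈p∪q⁺ (inj₁ x∈X)
    ... | no x∉X = x∈p∪q⁺ (inj₂ (x∈p∧x∉q⇒x∈p─q x∈Y x∉X))

  rank-∪-absorb : ∀ A B → (∀ y → y ∈ B → rank (A ∪ ⁅ y ⁆) ≤ rank A) → rank (A ∪ B) ≤ rank A
  rank-∪-absorb A B = go ∣ B ∣ B ≤-refl
    where
    go : ∀ k B → ∣ B ∣ ≤ k → (∀ y → y ∈ B → rank (A ∪ ⁅ y ⁆) ≤ rank A) → rank (A ∪ B) ≤ rank A
    go k B ∣B∣≤k absorbed with nonempty? B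
    ... | no B-empty = mono (∪-least ⊆-refl (λ y∈B → contradiction (_ , y∈B) B-empty))
    go zero B ∣B∣≤0 absorbed | yes (y , y∈B) =
      contradiction (subst (_≤ 0) (x∈p⇒∣p∣≡1+∣p-x∣ B y∈B) ∣B∣≤0) λ ()
    go (suc k) B ∣B∣≤1+k absorbed | yes (y , y∈B) = +-cancelʳ-≤ (rank A) _ _ (begin
      rank (A ∪ B) + rank A                                     ≤⟨ +-mono-≤ (mono A∪B⊆) (mono A⊆) ⟩
      rank ((A ∪ (B - y)) ∪ (A ∪ ⁅ y ⁆)) + rank ((A ∪ (B - y)) ∩ (A ∪ ⁅ y ⁆))
                                                                ≤⟨ rank-sub (A ∪ (B - y)) (A ∪ ⁅ y ⁆) ⟩
      rank (A ∪ (B - y)) + rank (A ∪ ⁅ y ⁆)                     ≤⟨ +-mono-≤ ih (absorbed y y∈B) ⟩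
      rank A + rank A                                           ∎)
      where
      open ≤-Reasoning
      ih : rank (A ∪ (B - y)) ≤ rank A
      ih = go k (B - y) (≤-pred (subst (_≤ suc k) (x∈p⇒∣p∣≡1+∣p-x∣ B y∈B) ∣B∣≤1+k))
             (λ z z∈ → absorbed z (p─q⊆p B ⁅ y ⁆ z∈))
      A∪B⊆ : A ∪ B ⊆ (A ∪ (B - y)) ∪ (A ∪ ⁅ y ⁆)
      A∪B⊆ = ∪-least (λ x∈A → x∈p∪q⁺ (inj₂ (x∈p∪q⁺ (inj₁ x∈A)))) B⊆
        where
        B⊆ : B ⊆ (A ∪ (B - y)) ∪ (A ∪ ⁅ y ⁆)
        B⊆ {x} x∈B with x Fin.≟ y
        ... | yes refl = x∈p∪q⁺ (inj₂ (x∈p∪q⁺ (inj₂ (x∈⁅x⁆ x))))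
        ... | no x≢y = x∈p∪q⁺ (inj₁ (x∈p∪q⁺ (inj₂ (x∈p∧x≢y⇒x∈p-y x∈B x≢y))))
      A⊆ : A ⊆ (A ∪ (B - y)) ∩ (A ∪ ⁅ y ⁆)
      A⊆ x∈A = x∈p∩q⁺ (x∈p∪q⁺ (inj₁ x∈A) , x∈p∪q⁺ (inj₁ x∈A))

  cl : Subset n → Subset n
  cl A = subsetOf (λ e → rank (A ∪ ⁅ e ⁆) ≤? rank A)

  ∈cl⁻ : e ∈ cl A → rank (A ∪ ⁅ e ⁆) ≤ rank A
  ∈cl⁻ {A = A} = ∈subsetOf⁻ (λ e → rank (A ∪ ⁅ e ⁆) ≤? rank A)

  ∈cl⁺ : rank (A ∪ ⁅ e ⁆) ≤ rank A → e ∈ cl A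
  ∈cl⁺ {A = A} = ∈subsetOf⁺ (λ e → rank (A ∪ ⁅ e ⁆) ≤? rank A)

  ⊆cl : ∀ A → A ⊆ cl A
  ⊆cl A e∈A = ∈cl⁺ (mono (∪-least ⊆-refl (x∈p⇒⁅x⁆⊆p e∈A)))

  rank-cl : ∀ A → rank (cl A) ≡ rank A
  rank-cl A = ≤-antisym
    (≤-trans (mono (q⊆p∪q A (cl A))) (rank-∪-absorb A (cl A) (λ _ → ∈cl⁻)))
    (mono (⊆cl A))

  cl-flat : ∀ A → Flat (cl A)
  cl-flat A e e∉cl = begin-strict
    rank (cl A)              ≡⟨ rank-cl A ⟩
    rank A                   <⟨ ≰⇒> (e∉cl ∘′ ∈cl⁺) ⟩
    rank (A ∪ ⁅ e ⁆)         ≤⟨ mono (∪-least (⊆-trans (⊆cl A) (p⊆p∪q ⁅ e ⁆)) (q⊆p∪q (cl A) ⁅ e ⁆)) ⟩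
    rank (cl A ∪ ⁅ e ⁆)      ∎
    where open ≤-Reasoning

  augment : rank A < rank ⊤ → ∃[ y ] rank A < rank (A ∪ ⁅ y ⁆)
  augment {A} rankA<rank⊤ with Fin.any? (λ y → suc (rank A) ≤? rank (A ∪ ⁅ y ⁆))
  ... | yes raising = raising
  ... | no ¬raising = contradiction
        (≤-trans (mono (q⊆p∪q A ⊤)) (rank-∪-absorb A ⊤ (λ y _ → ≮⇒≥ (λ A<A∪y → ¬raising (y , A<A∪y)))))
        (<⇒≱ rankA<rank⊤)

  flat-∩-rank< : Flat H → e ∈ X → e ∉ H → rank (H ∩ X) < rank X
  flat-∩-rank< {H} {e} {X} flatH e∈X e∉H = +-cancelˡ-≤ (rank H) _ _ (begin
    rank H + suc (rank (H ∩ X))    ≡⟨ +-suc (rank H) _ ⟩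
    suc (rank H) + rank (H ∩ X)    ≤⟨ +-monoˡ-≤ (rank (H ∩ X)) (flatH e e∉H) ⟩
    rank (H ∪ ⁅ e ⁆) + rank (H ∩ X) ≤⟨ +-monoˡ-≤ (rank (H ∩ X)) (mono H∪e⊆H∪X) ⟩
    rank (H ∪ X) + rank (H ∩ X)    ≤⟨ rank-sub H X ⟩
    rank H + rank X                ∎)
    where
    open ≤-Reasoning
    H∪e⊆H∪X : H ∪ ⁅ e ⁆ ⊆ H ∪ X
    H∪e⊆H∪X = ∪-least (p⊆p∪q X) (⊆-trans (x∈p⇒⁅x⁆⊆p e∈X) (q⊆p∪q H X))

  flat-⊆-rank≤⇒≡ : Flat F → F ⊆ G → rank G ≤ rank F → F ≡ G
  flat-⊆-rank≤⇒≡ {F} {G} flatF F⊆G rankG≤rankF = ⊆-antisym F⊆G G⊆F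
    where
    G⊆F : G ⊆ F
    G⊆F {e} e∈G with e ∈? F
    ... | yes e∈F = e∈F
    ... | no e∉F = contradiction
          (≤-trans (flatF e e∉F) (≤-trans (mono (∪-least F⊆G (x∈p⇒⁅x⁆⊆p e∈G))) rankG≤rankF))
          (n≮n (rank F))

  flat-extend-avoiding : ∀ {F} x → Flat F → x ∉ F → suc (suc (rank F)) ≤ rank ⊤ →
    ∃[ G ] (Flat G × rank G ≡ suc (rank F) × F ⊆ G × x ∉ G)
  flat-extend-avoiding {F} x flatF x∉F 2+rankF≤rank⊤ =
    cl (F ∪ ⁅ y ⁆) , cl-flat _ , trans (rank-cl _) rank[F∪y]≡1+rankF ,
    ⊆-trans (p⊆p∪q ⁅ y ⁆) (⊆cl _) , x∉cl
    where
    rank[F∪x]≡1+rankF : rank (F ∪ ⁅ x ⁆) ≡ suc (rank F)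
    rank[F∪x]≡1+rankF = ≤-antisym (rank-∪⁅⁆ F x) (flatF x x∉F)
    y-raising : ∃[ y ] rank (F ∪ ⁅ x ⁆) < rank ((F ∪ ⁅ x ⁆) ∪ ⁅ y ⁆)
    y-raising = augment (subst (_< rank ⊤) (sym rank[F∪x]≡1+rankF) 2+rankF≤rank⊤)
    y : Fin n
    y = proj₁ y-raising
    2+rankF≤rank[F∪x∪y] : suc (suc (rank F)) ≤ rank ((F ∪ ⁅ x ⁆) ∪ ⁅ y ⁆)
    2+rankF≤rank[F∪x∪y] = subst (λ k → suc k ≤ rank ((F ∪ ⁅ x ⁆) ∪ ⁅ y ⁆)) rank[F∪x]≡1+rankF (proj₂ y-raising)
    F∪x∪y⊆F∪y∪x : (F ∪ ⁅ x ⁆) ∪ ⁅ y ⁆ ⊆ (F ∪ ⁅ y ⁆) ∪ ⁅ x ⁆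
    F∪x∪y⊆F∪y∪x = ∪-least (∪-least (⊆-trans (p⊆p∪q ⁅ y ⁆) (p⊆p∪q ⁅ x ⁆)) (q⊆p∪q _ ⁅ x ⁆))
                          (⊆-trans (q⊆p∪q F ⁅ y ⁆) (p⊆p∪q ⁅ x ⁆))
    rank[F∪y]≡1+rankF : rank (F ∪ ⁅ y ⁆) ≡ suc (rank F)
    rank[F∪y]≡1+rankF = ≤-antisym (rank-∪⁅⁆ F y)
      (≤-pred (≤-trans 2+rankF≤rank[F∪x∪y] (≤-trans (mono F∪x∪y⊆F∪y∪x) (rank-∪⁅⁆ _ x))))
    x∉cl : x ∉ cl (F ∪ ⁅ y ⁆)
    x∉cl x∈cl = n≮n _ (≤-trans 2+rankF≤rank[F∪x∪y]
      (≤-trans (mono F∪x∪y⊆F∪y∪x) (subst (rank ((F ∪ ⁅ y ⁆) ∪ ⁅ x ⁆) ≤_) rank[F∪y]≡1+rankF (∈cl⁻ x∈cl))))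

  hyperplane-avoiding : ∀ {F} x → Flat F → x ∉ F → ∃[ H ] (Hyperplane H × F ⊆ H × x ∉ H)
  hyperplane-avoiding {F} x flatF x∉F =
    go (rank ⊤ ∸ suc (rank F)) F flatF x∉F ⊆-refl (m+[n∸m]≡n 1+rankF≤rank⊤)
    where
    1+rankF≤rank⊤ : suc (rank F) ≤ rank ⊤
    1+rankF≤rank⊤ = ≤-trans (flatF x x∉F) (rank≤rank⊤ _)
    go : ∀ k G → Flat G → x ∉ G → F ⊆ G → suc (rank G) + k ≡ rank ⊤ →
         ∃[ H ] (Hyperplane H × F ⊆ H × x ∉ H)
    go zero G flatG x∉G F⊆G rankG≡ = G , (flatG , trans (sym (+-identityʳ _)) rankG≡) , F⊆G , x∉G
    go (suc k) G flatG x∉G F⊆G rankG≡ with flat-extend-avoiding x flatG x∉G 2+rankG≤rank⊤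
      where
      2+rankG≤rank⊤ : suc (suc (rank G)) ≤ rank ⊤
      2+rankG≤rank⊤ = subst (suc (suc (rank G)) ≤_) (trans (sym (+-suc (suc (rank G)) k)) rankG≡)
                            (m≤m+n (suc (suc (rank G))) k)
    ... | G′ , flatG′ , rankG′≡ , G⊆G′ , x∉G′ =
      go k G′ flatG′ x∉G′ (⊆-trans F⊆G G⊆G′)
         (trans (cong (λ r → suc r + k) rankG′≡) (trans (sym (+-suc _ k)) rankG≡))

  flat-⊆-two-hyperplanes : Flat F → suc (suc (rank F)) ≡ rank ⊤ →
    ∃[ H₁ ] ∃[ H₂ ] (Hyperplane H₁ × Hyperplane H₂ × F ⊆ H₁ × F ⊆ H₂ × ∃[ x ] (x ∈ H₁ × x ∉ H₂))
  flat-⊆-two-hyperplanes {F} flatF 2+rankF≡rank⊤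
    with ⊈⇒∃∈∉ (λ ⊤⊆F → ≤⇒≯ (mono ⊤⊆F) (≤-trans (n≤1+n _) (≤-reflexive 2+rankF≡rank⊤)))
  ... | x , _ , x∉F with hyperplane-avoiding x flatF x∉F
  ... | H₁ , hypH₁@(_ , 1+rankH₁≡rank⊤) , F⊆H₁ , _
    with ⊈⇒∃∈∉ (λ H₁⊆F → ≤⇒≯ (mono H₁⊆F)
                  (≤-reflexive (suc-injective (trans 2+rankF≡rank⊤ (sym 1+rankH₁≡rank⊤)))))
  ... | x′ , x′∈H₁ , x′∉F with hyperplane-avoiding x′ flatF x′∉F
  ... | H₂ , hypH₂ , F⊆H₂ , x′∉H₂ = H₁ , H₂ , hypH₁ , hypH₂ , F⊆H₁ , F⊆H₂ , x′ , x′∈H₁ , x′∉H₂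

  circuit-nonempty : ∀ {C} → IsCircuit M C → Nonempty C
  circuit-nonempty {C} (dependentC , _) with nonempty? C
  ... | yes nonemptyC = nonemptyC
  ... | no emptyC = contradiction (subst (Independent M) (sym (Empty-unique emptyC))
                      (trans rank-⊥ (sym (∣⊥∣≡0 n)))) dependentC

  circuit-rank : ∀ {C} → IsCircuit M C → suc (rank C) ≡ ∣ C ∣
  circuit-rank {C} circuitC@(dependentC , minimalC) with circuit-nonempty circuitC
  ... | e , e∈C = trans (cong suc rankC≡∣C-e∣) (sym (x∈p⇒∣p∣≡1+∣p-x∣ C e∈C))
    where
    rankC≡∣C-e∣ : rank C ≡ ∣ C - e ∣
    rankC≡∣C-e∣ = ≤-antisym
      (≤-pred (subst (rank C <_) (x∈p⇒∣p∣≡1+∣p-x∣ C e∈C) (≤∧≢⇒< (rank-≤ C) dependentC)))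
      (subst (_≤ rank C) (minimalC (C - e) (x∈p⇒p-x⊂p e∈C)) (mono (p─q⊆p C ⁅ e ⁆)))

module Duality {n : ℕ} (M : Matroid n) where
  open Matroid M
  open MatroidProperties M
  open BooleanAlgebraProperties (∪-∩-booleanAlgebra n)
    using () renaming (¬-involutive to ∁-involutive; deMorgan₁ to ∁-∩; deMorgan₂ to ∁-∪; ¬⊤≈⊥ to ∁⊤≡⊥)

  private
    d : ℕ
    d = rank ⊤

  rank⊤≤∣X∣+rank∁X : ∀ X → d ≤ ∣ X ∣ + rank (∁ X)
  rank⊤≤∣X∣+rank∁X X = begin
    rank ⊤                 ≡⟨ cong rank (p∪∁p≡⊤ X) ⟨
    rank (X ∪ ∁ X)         ≤⟨ rank-∪ X (∁ X) ⟩
    rank X + rank (∁ X)    ≤⟨ +-monoˡ-≤ (rank (∁ X)) (rank-≤ X) ⟩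
    ∣ X ∣ + rank (∁ X)     ∎
    where open ≤-Reasoning

  dualRank+rank⊤ : ∀ X → dualRank M X + d ≡ ∣ X ∣ + rank (∁ X)
  dualRank+rank⊤ X = m∸n+n≡m (rank⊤≤∣X∣+rank∁X X)

  ∣X∣+rank∁X-mono : ∀ {X Y} → X ⊆ Y → ∣ X ∣ + rank (∁ X) ≤ ∣ Y ∣ + rank (∁ Y)
  ∣X∣+rank∁X-mono {X} {Y} X⊆Y = begin
    ∣ X ∣ + rank (∁ X)                   ≤⟨ +-monoʳ-≤ ∣ X ∣ (mono ∁X⊆∁Y∪[Y─X]) ⟩
    ∣ X ∣ + rank (∁ Y ∪ (Y ─ X))         ≤⟨ +-monoʳ-≤ ∣ X ∣ (rank-∪ (∁ Y) (Y ─ X)) ⟩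
    ∣ X ∣ + (rank (∁ Y) + rank (Y ─ X))  ≤⟨ +-monoʳ-≤ ∣ X ∣ (+-monoʳ-≤ (rank (∁ Y)) (rank-≤ (Y ─ X))) ⟩
    ∣ X ∣ + (rank (∁ Y) + ∣ Y ─ X ∣)     ≡⟨ cong (∣ X ∣ +_) (+-comm (rank (∁ Y)) _) ⟩
    ∣ X ∣ + (∣ Y ─ X ∣ + rank (∁ Y))     ≡⟨ +-assoc ∣ X ∣ _ _ ⟨
    (∣ X ∣ + ∣ Y ─ X ∣) + rank (∁ Y)     ≡⟨ cong (_+ rank (∁ Y)) (trans (+-comm ∣ X ∣ _) (q⊆p⇒∣p─q∣+∣q∣≡∣p∣ Y X X⊆Y)) ⟩
    ∣ Y ∣ + rank (∁ Y)                   ∎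
    where
    open ≤-Reasoning
    ∁X⊆∁Y∪[Y─X] : ∁ X ⊆ ∁ Y ∪ (Y ─ X)
    ∁X⊆∁Y∪[Y─X] {x} x∈∁X with x ∈? Y
    ... | yes x∈Y = x∈p∪q⁺ (inj₂ (x∈p∧x∉q⇒x∈p─q x∈Y (x∈∁p⇒x∉p x∈∁X)))
    ... | no x∉Y = x∈p∪q⁺ (inj₁ (x∉p⇒x∈∁p x∉Y))

  dualRank-≤ : ∀ X → dualRank M X ≤ ∣ X ∣
  dualRank-≤ X = +-cancelʳ-≤ d _ _ (begin
    dualRank M X + d        ≡⟨ dualRank+rank⊤ X ⟩
    ∣ X ∣ + rank (∁ X)      ≤⟨ +-monoʳ-≤ ∣ X ∣ (rank≤rank⊤ (∁ X)) ⟩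
    ∣ X ∣ + d               ∎)
    where open ≤-Reasoning

  dualRank-mono : ∀ X Y → X ⊆ Y → dualRank M X ≤ dualRank M Y
  dualRank-mono X Y X⊆Y = +-cancelʳ-≤ d _ _ (begin
    dualRank M X + d        ≡⟨ dualRank+rank⊤ X ⟩
    ∣ X ∣ + rank (∁ X)      ≤⟨ ∣X∣+rank∁X-mono X⊆Y ⟩
    ∣ Y ∣ + rank (∁ Y)      ≡⟨ dualRank+rank⊤ Y ⟨
    dualRank M Y + d        ∎)
    where open ≤-Reasoning

  dualRank-submodular : ∀ X Y → dualRank M (X ∪ Y) + dualRank M (X ∩ Y) ≤ dualRank M X + dualRank M Y
  dualRank-submodular X Y = +-cancelʳ-≤ (d + d) _ _ (begin
    (r* (X ∪ Y) + r* (X ∩ Y)) + (d + d)                     ≡⟨ interchange (r* (X ∪ Y)) (r* (X ∩ Y)) d d ⟩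
    (r* (X ∪ Y) + d) + (r* (X ∩ Y) + d)                     ≡⟨ cong₂ _+_ (dualRank+rank⊤ (X ∪ Y)) (dualRank+rank⊤ (X ∩ Y)) ⟩
    (∣ X ∪ Y ∣ + rank (∁ (X ∪ Y))) + (∣ X ∩ Y ∣ + rank (∁ (X ∩ Y)))
                             ≡⟨ interchange (∣ X ∪ Y ∣) (rank (∁ (X ∪ Y))) (∣ X ∩ Y ∣) (rank (∁ (X ∩ Y))) ⟩
    (∣ X ∪ Y ∣ + ∣ X ∩ Y ∣) + (rank (∁ (X ∪ Y)) + rank (∁ (X ∩ Y)))
                             ≡⟨ cong₂ _+_ (∣p∪q∣+∣p∩q∣≡∣p∣+∣q∣ X Y) (cong₂ _+_ (cong rank (∁-∪ X Y)) (cong rank (∁-∩ X Y))) ⟩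
    (∣ X ∣ + ∣ Y ∣) + (rank (∁ X ∩ ∁ Y) + rank (∁ X ∪ ∁ Y))  ≡⟨ cong ((∣ X ∣ + ∣ Y ∣) +_) (+-comm (rank (∁ X ∩ ∁ Y)) _) ⟩
    (∣ X ∣ + ∣ Y ∣) + (rank (∁ X ∪ ∁ Y) + rank (∁ X ∩ ∁ Y))  ≤⟨ +-monoʳ-≤ (∣ X ∣ + ∣ Y ∣) (rank-sub (∁ X) (∁ Y)) ⟩
    (∣ X ∣ + ∣ Y ∣) + (rank (∁ X) + rank (∁ Y))              ≡⟨ interchange (∣ X ∣) (∣ Y ∣) (rank (∁ X)) (rank (∁ Y)) ⟩
    (∣ X ∣ + rank (∁ X)) + (∣ Y ∣ + rank (∁ Y))              ≡⟨ cong₂ _+_ (dualRank+rank⊤ X) (dualRank+rank⊤ Y) ⟨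
    (r* X + d) + (r* Y + d)                                 ≡⟨ interchange (r* X) d (r* Y) d ⟩
    (r* X + r* Y) + (d + d)                                 ∎)
    where
    open ≤-Reasoning
    r* : Subset n → ℕ
    r* = dualRank M

  dual : Matroid n
  dual = record
    { rank      = dualRank M
    ; rank-≤    = dualRank-≤
    ; rank-mono = dualRank-mono
    ; rank-sub  = dualRank-submodular
    }

  module M* = MatroidProperties dual

  corank+rank⊤≡n : corank M + d ≡ n
  corank+rank⊤≡n = begin
    corank M + d              ≡⟨ dualRank+rank⊤ (⊤ {n}) ⟩
    ∣ ⊤ {n} ∣ + rank (∁ ⊤)    ≡⟨ cong₂ _+_ (∣⊤∣≡n n) (trans (cong rank ∁⊤≡⊥) rank-⊥) ⟩
    n + 0                     ≡⟨ +-identityʳ n ⟩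
    n                         ∎
    where open ≡-Reasoning

  dualRank+∣∁X∣≡corank+rank∁X : ∀ X → dualRank M X + ∣ ∁ X ∣ ≡ corank M + rank (∁ X)
  dualRank+∣∁X∣≡corank+rank∁X X = +-cancelʳ-≡ d _ _ (begin
    (dualRank M X + ∣ ∁ X ∣) + d     ≡⟨ +-comm (dualRank M X + ∣ ∁ X ∣) d ⟩
    d + (dualRank M X + ∣ ∁ X ∣)     ≡⟨ +-assoc d (dualRank M X) _ ⟨
    (d + dualRank M X) + ∣ ∁ X ∣     ≡⟨ cong (_+ ∣ ∁ X ∣) (trans (+-comm d _) (dualRank+rank⊤ X)) ⟩
    (∣ X ∣ + rank (∁ X)) + ∣ ∁ X ∣   ≡⟨ +-assoc (∣ X ∣) _ _ ⟩
    ∣ X ∣ + (rank (∁ X) + ∣ ∁ X ∣)   ≡⟨ cong (∣ X ∣ +_) (+-comm (rank (∁ X)) _) ⟩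
    ∣ X ∣ + (∣ ∁ X ∣ + rank (∁ X))   ≡⟨ +-assoc (∣ X ∣) _ _ ⟨
    (∣ X ∣ + ∣ ∁ X ∣) + rank (∁ X)   ≡⟨ cong (_+ rank (∁ X)) (trans (∣p∣+∣∁p∣≡n X) (sym corank+rank⊤≡n)) ⟩
    (corank M + d) + rank (∁ X)      ≡⟨ +-assoc (corank M) d _ ⟩
    corank M + (d + rank (∁ X))      ≡⟨ cong (corank M +_) (+-comm d _) ⟩
    corank M + (rank (∁ X) + d)      ≡⟨ +-assoc (corank M) _ d ⟨
    (corank M + rank (∁ X)) + d      ∎)
    where open ≡-Reasoning

  ∁-independent⇒dualRank≡corank : ∀ {X} → Independent M (∁ X) → dualRank M X ≡ corank M
  ∁-independent⇒dualRank≡corank {X} indep∁X = +-cancelʳ-≡ (∣ ∁ X ∣) _ _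
    (trans (dualRank+∣∁X∣≡corank+rank∁X X) (cong (corank M +_) indep∁X))

  dualRank≡corank⇒∁-independent : ∀ {X} → dualRank M X ≡ corank M → Independent M (∁ X)
  dualRank≡corank⇒∁-independent {X} r*X≡corank = +-cancelˡ-≡ (corank M) _ _
    (trans (sym (dualRank+∣∁X∣≡corank+rank∁X X)) (cong (_+ ∣ ∁ X ∣) r*X≡corank))

  circuit⇒∁-dual-hyperplane : ∀ {C} → IsCircuit M C → M*.Hyperplane (∁ C)
  circuit⇒∁-dual-hyperplane {C} circuitC@(_ , minimalC) = flat , 1+r*∁C≡corank
    where
    1+r*∁C≡corank : suc (dualRank M (∁ C)) ≡ corank M
    1+r*∁C≡corank = +-cancelʳ-≡ (rank C) _ _ (begin
      suc (dualRank M (∁ C)) + rank C        ≡⟨ +-suc (dualRank M (∁ C)) (rank C) ⟨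
      dualRank M (∁ C) + suc (rank C)        ≡⟨ cong (dualRank M (∁ C) +_) (circuit-rank circuitC) ⟩
      dualRank M (∁ C) + ∣ C ∣               ≡⟨ cong (λ X → dualRank M (∁ C) + ∣ X ∣) (∁-involutive C) ⟨
      dualRank M (∁ C) + ∣ ∁ (∁ C) ∣         ≡⟨ dualRank+∣∁X∣≡corank+rank∁X (∁ C) ⟩
      corank M + rank (∁ (∁ C))              ≡⟨ cong (λ X → corank M + rank X) (∁-involutive C) ⟩
      corank M + rank C                      ∎)
      where open ≡-Reasoning
    flat : M*.Flat (∁ C)
    flat e e∉∁C = begin-strict
      dualRank M (∁ C)                 <⟨ ≤-reflexive 1+r*∁C≡corank ⟩
      corank M                         ≡⟨ ∁-independent⇒dualRank≡corank indep ⟨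
      dualRank M (∁ C ∪ ⁅ e ⁆)         ∎
      where
      open ≤-Reasoning
      e∈C : e ∈ C
      e∈C = x∉∁p⇒x∈p e∉∁C
      ∁[∁C∪e]⊆C-e : ∁ (∁ C ∪ ⁅ e ⁆) ⊆ C - e
      ∁[∁C∪e]⊆C-e x∈ = x∈p∧x∉q⇒x∈p─q (x∉∁p⇒x∈p (x∈∁p⇒x∉p x∈ ∘′ p⊆p∪q ⁅ e ⁆))
                                      (x∈∁p⇒x∉p x∈ ∘′ q⊆p∪q (∁ C) ⁅ e ⁆)
      indep : Independent M (∁ (∁ C ∪ ⁅ e ⁆))
      indep = independent-⊆ (minimalC (C - e) (x∈p⇒p-x⊂p e∈C)) ∁[∁C∪e]⊆C-e

  ∁-dual-hyperplane⇒circuit : ∀ {H} → M*.Hyperplane H → IsCircuit M (∁ H)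
  ∁-dual-hyperplane⇒circuit {H} (flatH , 1+r*H≡corank) = dependent , minimal
    where
    dependent : Dependent M (∁ H)
    dependent indep∁H = 1+n≢n (trans 1+r*H≡corank (sym (∁-independent⇒dualRank≡corank indep∁H)))
    minimal : ∀ D → D ⊂ ∁ H → Independent M D
    minimal D (D⊆∁H , e , e∈∁H , e∉D) = independent-⊆ indep∁[H∪e] D⊆∁[H∪e]
      where
      e∉H : e ∉ H
      e∉H = x∈∁p⇒x∉p e∈∁H
      indep∁[H∪e] : Independent M (∁ (H ∪ ⁅ e ⁆))
      indep∁[H∪e] = dualRank≡corank⇒∁-independent
        (≤-antisym (M*.rank≤rank⊤ _) (subst (_≤ dualRank M (H ∪ ⁅ e ⁆)) 1+r*H≡corank (flatH e e∉H)))
      D⊆∁[H∪e] : D ⊆ ∁ (H ∪ ⁅ e ⁆)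
      D⊆∁[H∪e] {x} x∈D = x∉p⇒x∈∁p λ x∈H∪e → case x∈p∪q⁻ H ⁅ e ⁆ x∈H∪e of λ
        { (inj₁ x∈H) → x∈∁p⇒x∉p (D⊆∁H x∈D) x∈H
        ; (inj₂ x∈⁅e⁆) → e∉D (subst (_∈ D) (x∈⁅y⁆⇒x≡y e x∈⁅e⁆) x∈D) }

private
  u+p≡a+b∧p<a∧u≤4⇒b≤3 : ∀ {u p a b} → u + p ≡ a + b → p < a → u ≤ 4 → b ≤ 3
  u+p≡a+b∧p<a∧u≤4⇒b≤3 {u} {p} {a} {b} u+p≡a+b p<a u≤4 = ≤-pred (+-cancelʳ-≤ p _ _ (begin
    suc b + p     ≡⟨ +-suc b p ⟨
    b + suc p     ≤⟨ +-monoʳ-≤ b p<a ⟩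
    b + a         ≡⟨ trans (+-comm b a) (sym u+p≡a+b) ⟩
    u + p         ≤⟨ +-monoˡ-≤ p u≤4 ⟩
    4 + p         ∎))
    where open ≤-Reasoning

elimination-sizes : ∀ {u p a₁ a₂} → u + p ≡ a₁ + a₂ → p < a₁ → p < a₂ → 3 ≤ a₁ → 3 ≤ a₂ → u ≤ 4 →
  a₁ ≡ 3 × a₂ ≡ 3 × p ≡ 2 × u ≡ 4
elimination-sizes {u} {p} {a₁} {a₂} u+p≡a₁+a₂ p<a₁ p<a₂ 3≤a₁ 3≤a₂ u≤4 = a₁≡3 , a₂≡3 , p≡2 , u≡4
  where
  a₁≡3 : a₁ ≡ 3
  a₁≡3 = ≤-antisym (u+p≡a+b∧p<a∧u≤4⇒b≤3 (trans u+p≡a₁+a₂ (+-comm a₁ a₂)) p<a₂ u≤4) 3≤a₁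
  a₂≡3 : a₂ ≡ 3
  a₂≡3 = ≤-antisym (u+p≡a+b∧p<a∧u≤4⇒b≤3 u+p≡a₁+a₂ p<a₁ u≤4) 3≤a₂
  u+p≡6 : u + p ≡ 6
  u+p≡6 = trans u+p≡a₁+a₂ (cong₂ _+_ a₁≡3 a₂≡3)
  p≡2 : p ≡ 2
  p≡2 = ≤-antisym (≤-pred (subst (p <_) a₁≡3 p<a₁))
                  (+-cancelˡ-≤ 4 _ _ (subst (_≤ 4 + p) u+p≡6 (+-monoˡ-≤ p u≤4)))
  u≡4 : u ≡ 4
  u≡4 = +-cancelʳ-≡ p u 4 (trans u+p≡6 (cong (4 +_) (sym p≡2)))

module _ {m : ℕ} (𝔄 : Family m) where

  UpClosed : Set
  UpClosed = ∀ {A B} → 𝔄 A → A ⊆ B → 𝔄 B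

  EliminationClosed : Set
  EliminationClosed = ∀ {A₁ A₂ C} → 𝔄 A₁ → 𝔄 A₂ → ¬ 𝔄 (A₁ ∩ A₂) → C ∈ A₁ ∩ A₂ → 𝔄 ((A₁ ∪ A₂) ─ ⁅ C ⁆)

  ⊆stage : ∀ i {A} → 𝔄 A → stage 𝔄 i A
  ⊆stage zero 𝔄A = 𝔄A
  ⊆stage (suc i) 𝔄A = _ , inj₁ (⊆stage i 𝔄A) , ⊆-refl

  stage⊆ : UpClosed → EliminationClosed → ∀ i {A} → stage 𝔄 i A → 𝔄 A
  stage⊆ _ _ zero 𝔄A = 𝔄A
  stage⊆ up elim (suc i) (A′ , ε𝔄A′ , A′⊆A) = up (ε⊆ ε𝔄A′) A′⊆A
    where
    ε⊆ : ∀ {B} → ε (stage 𝔄 i) B → 𝔄 B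
    ε⊆ (inj₁ B∈stage) = stage⊆ up elim i B∈stage
    ε⊆ (inj₂ (A₁ , A₂ , C , A₁∈ , A₂∈ , A₁∩A₂∉ , C∈ , refl)) =
      elim (stage⊆ up elim i A₁∈) (stage⊆ up elim i A₂∈) (A₁∩A₂∉ ∘′ ⊆stage i) C∈

  D⊆ : UpClosed → EliminationClosed → ∀ {A} → D 𝔄 A → 𝔄 A
  D⊆ up elim (i , A∈stage) = stage⊆ up elim i A∈stage

module _ {m : ℕ} (Dep : Family m) where

  HasRankN-unique : ∀ {X k k′} → HasRankN Dep X k → HasRankN Dep X k′ → k ≡ k′
  HasRankN-unique ((I , I⊆X , indepI , ∣I∣≡k) , maxk) ((I′ , I′⊆X , indepI′ , ∣I′∣≡k′) , maxk′) =
    ≤-antisym (subst (_≤ _) ∣I∣≡k (maxk′ I I⊆X indepI)) (subst (_≤ _) ∣I′∣≡k′ (maxk I′ I′⊆X indepI′))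

module CorankThree {n : ℕ} (M : Matroid n) (corank≡3 : corank M ≡ 3) {m : ℕ} (en : CircuitEnumeration M m) where
  open Matroid M
  open CircuitEnumeration en
  open Duality M
  open BooleanAlgebraProperties (∪-∩-booleanAlgebra n) using () renaming (¬-involutive to ∁-involutive)

  private
    r* : Subset n → ℕ
    r* = dualRank M

    ⋂H : Subset m → Subset n
    ⋂H = interCompl M en

    variable
      i j : Fin m
      S : Subset m
      F G X : Subset n

  H : Fin m → Subset n
  H i = ∁ (circ i)

  H-hyperplane : ∀ i → M*.Hyperplane (H i)
  H-hyperplane i = circuit⇒∁-dual-hyperplane (circ-circuit i)

  H-flat : ∀ i → M*.Flat (H i)
  H-flat i = proj₁ (H-hyperplane i)

  r*H≡2 : ∀ i → r* (H i) ≡ 2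
  r*H≡2 i = suc-injective (trans (proj₂ (H-hyperplane i)) corank≡3)

  r*≤3 : ∀ X → r* X ≤ 3
  r*≤3 X = subst (r* X ≤_) corank≡3 (M*.rank≤rank⊤ X)

  hyperplane⇒H : M*.Hyperplane X → ∃[ i ] H i ≡ X
  hyperplane⇒H {X} hypX with circ-onto (∁ X) (∁-dual-hyperplane⇒circuit hypX)
  ... | i , circ-i≡∁X = i , trans (cong ∁ circ-i≡∁X) (∁-involutive X)

  H-⊆⇒≡ : H i ⊆ H j → i ≡ j
  H-⊆⇒≡ {i} {j} Hi⊆Hj = circ-injective i j (begin
    circ i           ≡⟨ ∁-involutive (circ i) ⟨
    ∁ (H i)          ≡⟨ cong ∁ (M*.flat-⊆-rank≤⇒≡ (H-flat i) Hi⊆Hj (≤-reflexive (trans (r*H≡2 j) (sym (r*H≡2 i))))) ⟩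
    ∁ (H j)          ≡⟨ ∁-involutive (circ j) ⟩
    circ j           ∎)
    where open ≡-Reasoning

  r*[H∩H]≤1 : i ≢ j → r* (H i ∩ H j) ≤ 1
  r*[H∩H]≤1 {i} {j} i≢j with H j ⊆? H i
  ... | yes Hj⊆Hi = contradiction (sym (H-⊆⇒≡ Hj⊆Hi)) i≢j
  ... | no Hj⊈Hi with ⊈⇒∃∈∉ Hj⊈Hi
  ...   | x , x∈Hj , x∉Hi = ≤-pred (subst (r* (H i ∩ H j) <_) (r*H≡2 j) (M*.flat-∩-rank< (H-flat i) x∈Hj x∉Hi))

  flat⊆H-avoiding : ∀ {x} → M*.Flat F → x ∉ F → ∃[ i ] (F ⊆ H i × x ∈ circ i)
  flat⊆H-avoiding {F} {x} flatF x∉F with M*.hyperplane-avoiding x flatF x∉F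
  ... | X , hypX , F⊆X , x∉X with hyperplane⇒H hypX
  ...   | i , refl = i , F⊆X , x∉∁p⇒x∈p x∉X

  private
    factor : Subset m → Fin m → Subset n
    factor S i = if lookup S i then H i else ⊤

  ∈⋂H⁻ : ∀ S {x i} → x ∈ ⋂H S → i ∈ S → x ∈ H i
  ∈⋂H⁻ S {x} {i} x∈ i∈S = subst (λ b → x ∈ (if b then H i else ⊤)) ([]=⇒lookup i∈S)
    (x∈⋂⁻ (map (factor S) (allFin m)) x∈ (∈-map⁺ (factor S) (∈-allFin i)))

  ∈⋂H⁺ : ∀ S {x} → (∀ {i} → i ∈ S → x ∈ H i) → x ∈ ⋂H S
  ∈⋂H⁺ S {x} x∈H = x∈⋂⁺ (map (factor S) (allFin m)) λ p∈ → case ∈-map⁻ (factor S) p∈ of λ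
    { (i , _ , refl) → x∈if i }
    where
    x∈if : ∀ i → x ∈ factor S i
    x∈if i with lookup S i in S[i]
    ... | true = x∈H (lookup⇒[]= i S S[i])
    ... | false = ∈⊤

  ⋂H-anti : ∀ S T → S ⊆ T → ⋂H T ⊆ ⋂H S
  ⋂H-anti S T S⊆T x∈ = ∈⋂H⁺ S (λ i∈S → ∈⋂H⁻ T x∈ (S⊆T i∈S))

  ⋂H⊆H⇒⋂H⊆⋂H[∪⁅⁆] : ∀ S d → ⋂H S ⊆ H d → ⋂H S ⊆ ⋂H (S ∪ ⁅ d ⁆)
  ⋂H⊆H⇒⋂H⊆⋂H[∪⁅⁆] S d ⋂HS⊆Hd x∈ = ∈⋂H⁺ (S ∪ ⁅ d ⁆) λ j∈ → case x∈p∪q⁻ S ⁅ d ⁆ j∈ of λ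
    { (inj₁ j∈S) → ∈⋂H⁻ S x∈ j∈S
    ; (inj₂ j∈⁅d⁆) → subst (λ l → _ ∈ H l) (sym (x∈⁅y⁆⇒x≡y d j∈⁅d⁆)) (⋂HS⊆Hd x∈) }

  InS⇒∣S∣+r*≤3 : ∀ S → InS M en S → ∣ S ∣ + r* (⋂H S) ≤ 3
  InS⇒∣S∣+r*≤3 S S∈𝒮 =
    m≤o∸n⇒m+n≤o ∣ S ∣ (r*≤3 (⋂H S)) (subst (λ c → ∣ S ∣ ≤ c ∸ r* (⋂H S)) corank≡3 S∈𝒮)

  ∣S∣+r*≤3⇒InS : ∀ S → ∣ S ∣ + r* (⋂H S) ≤ 3 → InS M en S
  ∣S∣+r*≤3⇒InS S le = subst (λ c → ∣ S ∣ ≤ c ∸ r* (⋂H S)) (sym corank≡3) (m+n≤o⇒m≤o∸n ∣ S ∣ le)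

  InS? : ∀ S → Dec (InS M en S)
  InS? S = ∣ S ∣ ≤? corank M ∸ r* (⋂H S)

  InS⇒∣S∣≤3 : ∀ S → InS M en S → ∣ S ∣ ≤ 3
  InS⇒∣S∣≤3 S S∈𝒮 = ≤-trans (m≤m+n _ _) (InS⇒∣S∣+r*≤3 S S∈𝒮)

  ∣S∣≤2⇒InS : ∀ S → ∣ S ∣ ≤ 2 → InS M en S
  ∣S∣≤2⇒InS S ∣S∣≤2 with nonempty? S
  ... | no emptyS = ∣S∣+r*≤3⇒InS S (subst (λ c → c + r* (⋂H S) ≤ 3) (sym ∣S∣≡0) (r*≤3 (⋂H S)))
    where
    ∣S∣≡0 : ∣ S ∣ ≡ 0
    ∣S∣≡0 = trans (cong ∣_∣ (Empty-unique emptyS)) (∣⊥∣≡0 m)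
  ... | yes (i , i∈S) with nonempty? (S - i)
  ...   | no emptyS-i = ∣S∣+r*≤3⇒InS S (subst (λ c → c + r* (⋂H S) ≤ 3) (sym ∣S∣≡1)
            (s≤s (≤-trans (M*.mono (λ x∈ → ∈⋂H⁻ S x∈ i∈S)) (≤-reflexive (r*H≡2 i)))))
    where
    ∣S∣≡1 : ∣ S ∣ ≡ 1
    ∣S∣≡1 = trans (x∈p⇒∣p∣≡1+∣p-x∣ S i∈S) (cong suc (trans (cong ∣_∣ (Empty-unique emptyS-i)) (∣⊥∣≡0 m)))
  ...   | yes (j , j∈S-i) = ∣S∣+r*≤3⇒InS S (+-mono-≤ ∣S∣≤2
            (≤-trans (M*.mono (λ x∈ → x∈p∩q⁺ (∈⋂H⁻ S x∈ i∈S , ∈⋂H⁻ S x∈ (p─q⊆p S ⁅ i ⁆ j∈S-i))))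
                     (r*[H∩H]≤1 i≢j)))
    where
    i≢j : i ≢ j
    i≢j refl = x∈p─q⇒x∉q S ⁅ i ⁆ j∈S-i (x∈⁅x⁆ i)

  ¬InS⇒3≤∣S∣ : ∀ S → ¬ InS M en S → 3 ≤ ∣ S ∣
  ¬InS⇒3≤∣S∣ S S∉𝒮 = decidable-stable (3 ≤? ∣ S ∣) (λ 3≰∣S∣ → S∉𝒮 (∣S∣≤2⇒InS S (≤-pred (≰⇒> 3≰∣S∣))))

  4≤∣S∣⇒¬InS : ∀ S → 4 ≤ ∣ S ∣ → ¬ InS M en S
  4≤∣S∣⇒¬InS S 4≤∣S∣ S∈𝒮 = contradiction (≤-trans 4≤∣S∣ (InS⇒∣S∣≤3 S S∈𝒮)) λ { (s≤s (s≤s (s≤s ()))) }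

  1≤r*⇒¬InS : ∀ S → ∣ S ∣ ≡ 3 → 1 ≤ r* (⋂H S) → ¬ InS M en S
  1≤r*⇒¬InS S ∣S∣≡3 1≤r* S∈𝒮 = contradiction
    (≤-trans (+-monoʳ-≤ 3 1≤r*) (subst (λ c → c + r* (⋂H S) ≤ 3) ∣S∣≡3 (InS⇒∣S∣+r*≤3 S S∈𝒮)))
    λ { (s≤s (s≤s (s≤s ()))) }

  ¬InS⇒1≤r* : ∀ S → ∣ S ∣ ≡ 3 → ¬ InS M en S → 1 ≤ r* (⋂H S)
  ¬InS⇒1≤r* S ∣S∣≡3 S∉𝒮 = decidable-stable (1 ≤? r* (⋂H S)) λ 1≰r* →
    S∉𝒮 (∣S∣+r*≤3⇒InS S (subst (λ c → c + r* (⋂H S) ≤ 3) (sym ∣S∣≡3)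
      (≤-reflexive (cong (3 +_) (n≤0⇒n≡0 (≤-pred (≰⇒> 1≰r*)))))))

  triple-InS : ∀ {i j k x} → i ≢ j → x ∈ H i → x ∈ H j → x ∈ circ k →
    InS M en ((⁅ i ⁆ ∪ ⁅ j ⁆) ∪ ⁅ k ⁆) × ∣ (⁅ i ⁆ ∪ ⁅ j ⁆) ∪ ⁅ k ⁆ ∣ ≡ 3
  triple-InS {i} {j} {k} {x} i≢j x∈Hi x∈Hj x∈Ck =
    ∣S∣+r*≤3⇒InS ijk (subst (λ c → c + r* (⋂H ijk) ≤ 3) (sym ∣ijk∣≡3) (≤-reflexive (cong (3 +_) r*⋂Hijk≡0)))
    , ∣ijk∣≡3
    where
    ijk : Subset m
    ijk = (⁅ i ⁆ ∪ ⁅ j ⁆) ∪ ⁅ k ⁆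
    ⋂Hijk⊆Hk∩[Hi∩Hj] : ⋂H ijk ⊆ H k ∩ (H i ∩ H j)
    ⋂Hijk⊆Hk∩[Hi∩Hj] x∈ = x∈p∩q⁺ (∈⋂H⁻ ijk x∈ (q⊆p∪q _ ⁅ k ⁆ (x∈⁅x⁆ k)) ,
      x∈p∩q⁺ (∈⋂H⁻ ijk x∈ (p⊆p∪q ⁅ k ⁆ (p⊆p∪q ⁅ j ⁆ (x∈⁅x⁆ i))) ,
              ∈⋂H⁻ ijk x∈ (p⊆p∪q ⁅ k ⁆ (q⊆p∪q ⁅ i ⁆ ⁅ j ⁆ (x∈⁅x⁆ j)))))
    r*⋂Hijk≡0 : r* (⋂H ijk) ≡ 0
    r*⋂Hijk≡0 = n≤0⇒n≡0 (≤-pred (begin-strict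
      r* (⋂H ijk)                ≤⟨ M*.mono ⋂Hijk⊆Hk∩[Hi∩Hj] ⟩
      r* (H k ∩ (H i ∩ H j))     <⟨ M*.flat-∩-rank< (H-flat k) (x∈p∩q⁺ (x∈Hi , x∈Hj)) (x∈p⇒x∉∁p x∈Ck) ⟩
      r* (H i ∩ H j)             ≤⟨ r*[H∩H]≤1 i≢j ⟩
      1                          ∎))
      where open ≤-Reasoning
    k∉ij : k ∉ ⁅ i ⁆ ∪ ⁅ j ⁆
    k∉ij k∈ with x∈p∪q⁻ ⁅ i ⁆ ⁅ j ⁆ k∈
    ... | inj₁ k∈⁅i⁆ = x∈∁p⇒x∉p (subst (λ l → x ∈ H l) (sym (x∈⁅y⁆⇒x≡y i k∈⁅i⁆)) x∈Hi) x∈Ck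
    ... | inj₂ k∈⁅j⁆ = x∈∁p⇒x∉p (subst (λ l → x ∈ H l) (sym (x∈⁅y⁆⇒x≡y j k∈⁅j⁆)) x∈Hj) x∈Ck
    ∣ijk∣≡3 : ∣ ijk ∣ ≡ 3
    ∣ijk∣≡3 = trans (x∉p⇒∣p∪⁅x⁆∣≡1+∣p∣ _ k∉ij) (cong suc (x≢y⇒∣⁅x⁆∪⁅y⁆∣≡2 i≢j))

  ¬InS-upClosed : UpClosed (λ S → ¬ InS M en S)
  ¬InS-upClosed {A} {B} A∉𝒮 A⊆B with 4 ≤? ∣ B ∣
  ... | yes 4≤∣B∣ = 4≤∣S∣⇒¬InS B 4≤∣B∣
  ... | no 4≰∣B∣ = subst (λ S → ¬ InS M en S) A≡B A∉𝒮
    where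
    A≡B : A ≡ B
    A≡B = ⊆∧∣q∣≤∣p∣⇒≡ A⊆B (≤-trans (≤-pred (≰⇒> 4≰∣B∣)) (¬InS⇒3≤∣S∣ A A∉𝒮))

  InS-⊂-¬InS : ∀ P A → InS M en P → ¬ InS M en A → P ⊆ A → ∣ P ∣ < ∣ A ∣
  InS-⊂-¬InS P A P∈𝒮 A∉𝒮 P⊆A = ≰⇒> λ ∣A∣≤∣P∣ → A∉𝒮 (subst (InS M en) (⊆∧∣q∣≤∣p∣⇒≡ P⊆A ∣A∣≤∣P∣) P∈𝒮)

  dependent-triple⇒⋂H⊆H : ∀ P d → InS M en P → ∣ P ∣ ≡ 2 →
    ¬ InS M en (P ∪ ⁅ d ⁆) → ∣ P ∪ ⁅ d ⁆ ∣ ≡ 3 → ⋂H P ⊆ H d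
  dependent-triple⇒⋂H⊆H P d P∈𝒮 ∣P∣≡2 Pd∉𝒮 ∣Pd∣≡3 with ⋂H P ⊆? H d
  ... | yes ⋂HP⊆Hd = ⋂HP⊆Hd
  ... | no ⋂HP⊈Hd with ⊈⇒∃∈∉ ⋂HP⊈Hd
  ...   | x , x∈⋂HP , x∉Hd = contradiction (begin-strict
      1                      ≤⟨ ¬InS⇒1≤r* (P ∪ ⁅ d ⁆) ∣Pd∣≡3 Pd∉𝒮 ⟩
      r* (⋂H (P ∪ ⁅ d ⁆))    ≤⟨ M*.mono ⋂HPd⊆Hd∩⋂HP ⟩
      r* (H d ∩ ⋂H P)        <⟨ M*.flat-∩-rank< (H-flat d) x∈⋂HP x∉Hd ⟩
      r* (⋂H P)              ≤⟨ +-cancelˡ-≤ 2 _ _ (subst (λ c → c + r* (⋂H P) ≤ 3) ∣P∣≡2 (InS⇒∣S∣+r*≤3 P P∈𝒮)) ⟩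
      1                      ∎) (n≮n 1)
    where
    open ≤-Reasoning
    ⋂HPd⊆Hd∩⋂HP : ⋂H (P ∪ ⁅ d ⁆) ⊆ H d ∩ ⋂H P
    ⋂HPd⊆Hd∩⋂HP x∈ = x∈p∩q⁺ (∈⋂H⁻ (P ∪ ⁅ d ⁆) x∈ (q⊆p∪q P ⁅ d ⁆ (x∈⁅x⁆ d)) , ⋂H-anti P (P ∪ ⁅ d ⁆) (p⊆p∪q ⁅ d ⁆) x∈)

  -- Counting forces |A₁| = |A₂| = |R| = 3 and A₂ = P ∪ {d}; as H d contains the line ⋂H P,
  -- ⋂H A₁ ⊆ ⋂H R, so R inherits the dependence of A₁.
  ¬InS-elimination-small : ∀ A₁ A₂ C → ¬ InS M en A₁ → ¬ InS M en A₂ → InS M en (A₁ ∩ A₂) → C ∈ A₁ ∩ A₂ →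
    ∣ (A₁ ∪ A₂) ─ ⁅ C ⁆ ∣ ≤ 3 → ¬ InS M en ((A₁ ∪ A₂) ─ ⁅ C ⁆)
  ¬InS-elimination-small A₁ A₂ C A₁∉𝒮 A₂∉𝒮 P∈𝒮 C∈P ∣R∣≤3 =
    1≤r*⇒¬InS R ∣R∣≡3 (≤-trans (¬InS⇒1≤r* A₁ ∣A₁∣≡3 A₁∉𝒮) (M*.mono ⋂HA₁⊆⋂HR))
    where
    P R : Subset m
    P = A₁ ∩ A₂
    R = (A₁ ∪ A₂) ─ ⁅ C ⁆
    ∣A₁∪A₂∣≡1+∣R∣ : ∣ A₁ ∪ A₂ ∣ ≡ suc ∣ R ∣
    ∣A₁∪A₂∣≡1+∣R∣ = x∈p⇒∣p∣≡1+∣p-x∣ (A₁ ∪ A₂) (p⊆p∪q A₂ (p∩q⊆p A₁ A₂ C∈P))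
    sizes : ∣ A₁ ∣ ≡ 3 × ∣ A₂ ∣ ≡ 3 × ∣ P ∣ ≡ 2 × ∣ A₁ ∪ A₂ ∣ ≡ 4
    sizes = elimination-sizes (∣p∪q∣+∣p∩q∣≡∣p∣+∣q∣ A₁ A₂)
      (InS-⊂-¬InS P A₁ P∈𝒮 A₁∉𝒮 (p∩q⊆p A₁ A₂)) (InS-⊂-¬InS P A₂ P∈𝒮 A₂∉𝒮 (p∩q⊆q A₁ A₂))
      (¬InS⇒3≤∣S∣ A₁ A₁∉𝒮) (¬InS⇒3≤∣S∣ A₂ A₂∉𝒮) (subst (_≤ 4) (sym ∣A₁∪A₂∣≡1+∣R∣) (s≤s ∣R∣≤3))
    ∣A₁∣≡3 : ∣ A₁ ∣ ≡ 3
    ∣A₁∣≡3 = proj₁ sizes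
    ∣A₂∣≡3 : ∣ A₂ ∣ ≡ 3
    ∣A₂∣≡3 = proj₁ (proj₂ sizes)
    ∣P∣≡2 : ∣ P ∣ ≡ 2
    ∣P∣≡2 = proj₁ (proj₂ (proj₂ sizes))
    ∣R∣≡3 : ∣ R ∣ ≡ 3
    ∣R∣≡3 = suc-injective (trans (sym ∣A₁∪A₂∣≡1+∣R∣) (proj₂ (proj₂ (proj₂ sizes))))
    A₂-extra : ∃[ d ] (d ∈ A₂ × d ∉ P)
    A₂-extra = ⊈⇒∃∈∉ {p = A₂} {q = P} λ A₂⊆P →
      <⇒≱ (InS-⊂-¬InS P A₂ P∈𝒮 A₂∉𝒮 (p∩q⊆q A₁ A₂)) (p⊆q⇒∣p∣≤∣q∣ A₂⊆P)
    d : Fin m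
    d = proj₁ A₂-extra
    ∣P∪d∣≡3 : ∣ P ∪ ⁅ d ⁆ ∣ ≡ 3
    ∣P∪d∣≡3 = trans (x∉p⇒∣p∪⁅x⁆∣≡1+∣p∣ P (proj₂ (proj₂ A₂-extra))) (cong suc ∣P∣≡2)
    P∪d≡A₂ : P ∪ ⁅ d ⁆ ≡ A₂
    P∪d≡A₂ = ⊆∧∣q∣≤∣p∣⇒≡ (∪-least (p∩q⊆q A₁ A₂) (x∈p⇒⁅x⁆⊆p (proj₁ (proj₂ A₂-extra))))
                        (≤-reflexive (trans ∣A₂∣≡3 (sym ∣P∪d∣≡3)))
    ⋂HP⊆Hd : ⋂H P ⊆ H d
    ⋂HP⊆Hd = dependent-triple⇒⋂H⊆H P d P∈𝒮 ∣P∣≡2 (subst (λ S → ¬ InS M en S) (sym P∪d≡A₂) A₂∉𝒮) ∣P∪d∣≡3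
    R⊆A₁∪d : R ⊆ A₁ ∪ ⁅ d ⁆
    R⊆A₁∪d j∈R with x∈p∪q⁻ A₁ A₂ (p─q⊆p (A₁ ∪ A₂) ⁅ C ⁆ j∈R)
    ... | inj₁ j∈A₁ = p⊆p∪q ⁅ d ⁆ j∈A₁
    ... | inj₂ j∈A₂ = ∪-least (⊆-trans (p∩q⊆p A₁ A₂) (p⊆p∪q ⁅ d ⁆)) (q⊆p∪q A₁ ⁅ d ⁆) (subst (_ ∈_) (sym P∪d≡A₂) j∈A₂)
    ⋂HA₁⊆⋂HR : ⋂H A₁ ⊆ ⋂H R
    ⋂HA₁⊆⋂HR = ⊆-trans (⋂H⊆H⇒⋂H⊆⋂H[∪⁅⁆] A₁ d (⊆-trans (⋂H-anti P A₁ (p∩q⊆p A₁ A₂)) ⋂HP⊆Hd))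
                       (⋂H-anti R (A₁ ∪ ⁅ d ⁆) R⊆A₁∪d)

  ¬InS-eliminationClosed : EliminationClosed (λ S → ¬ InS M en S)
  ¬InS-eliminationClosed {A₁} {A₂} {C} A₁∉𝒮 A₂∉𝒮 ¬P∉𝒮 C∈P with 4 ≤? ∣ (A₁ ∪ A₂) ─ ⁅ C ⁆ ∣
  ... | yes 4≤∣R∣ = 4≤∣S∣⇒¬InS ((A₁ ∪ A₂) ─ ⁅ C ⁆) 4≤∣R∣
  ... | no 4≰∣R∣ = ¬InS-elimination-small A₁ A₂ C A₁∉𝒮 A₂∉𝒮
        (decidable-stable (InS? (A₁ ∩ A₂)) ¬P∉𝒮) C∈P (≤-pred (≰⇒> 4≰∣R∣))

  private
    Dep : Family m
    Dep = derivedDependent M en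

  δ-dependent⇒¬InS : Dep S → ¬ InS M en S
  δ-dependent⇒¬InS = D⊆ (λ S → ¬ InS M en S) ¬InS-upClosed ¬InS-eliminationClosed

  InS⇒δ-independent : ∀ S → InS M en S → IndepN Dep S
  InS⇒δ-independent S S∈𝒮 S-dep = δ-dependent⇒¬InS S-dep S∈𝒮

  δ-independent⇒InS : ∀ S → IndepN Dep S → InS M en S
  δ-independent⇒InS S S-indep = decidable-stable (InS? S) λ S∉𝒮 → S-indep (0 , S∉𝒮)

  hasRank : ∀ X k I → I ⊆ X → InS M en I → ∣ I ∣ ≡ k →
    (∀ J → J ⊆ X → InS M en J → ∣ J ∣ ≤ k) → HasRankN Dep X k
  hasRank X k I I⊆X I∈𝒮 ∣I∣≡k maximal =
    (I , I⊆X , InS⇒δ-independent I I∈𝒮 , ∣I∣≡k) , λ J J⊆X J-indep → maximal J J⊆X (δ-independent⇒InS J J-indep)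

  hasRank-self : ∀ X → InS M en X → HasRankN Dep X ∣ X ∣
  hasRank-self X X∈𝒮 = hasRank X ∣ X ∣ X ⊆-refl X∈𝒮 refl (λ J J⊆X _ → p⊆q⇒∣p∣≤∣q∣ J⊆X)

  InS⁅i⁆ : ∀ i → InS M en ⁅ i ⁆
  InS⁅i⁆ i = ∣S∣≤2⇒InS ⁅ i ⁆ (≤-trans (≤-reflexive (∣⁅x⁆∣≡1 i)) (s≤s z≤n))

  rank⁅i⁆≡1 : ∀ i → HasRankN Dep ⁅ i ⁆ 1
  rank⁅i⁆≡1 i = subst (HasRankN Dep ⁅ i ⁆) (∣⁅x⁆∣≡1 i) (hasRank-self ⁅ i ⁆ (InS⁅i⁆ i))

  rank⁅i,j⁆≡2 : ∀ {i j} → i ≢ j → HasRankN Dep (⁅ i ⁆ ∪ ⁅ j ⁆) 2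
  rank⁅i,j⁆≡2 {i} {j} i≢j = subst (HasRankN Dep (⁅ i ⁆ ∪ ⁅ j ⁆)) (x≢y⇒∣⁅x⁆∪⁅y⁆∣≡2 i≢j)
    (hasRank-self (⁅ i ⁆ ∪ ⁅ j ⁆) (∣S∣≤2⇒InS (⁅ i ⁆ ∪ ⁅ j ⁆) (≤-reflexive (x≢y⇒∣⁅x⁆∪⁅y⁆∣≡2 i≢j))))

  δ-cl⁅i⁆⇔≡ : ∀ i c → InClN Dep ⁅ i ⁆ c ⇔ c ≡ i
  δ-cl⁅i⁆⇔≡ i c = mk⇔ to from
    where
    to : InClN Dep ⁅ i ⁆ c → c ≡ i
    to (k , rank⁅i⁆≡k , rank⁅i,c⁆≡k) = decidable-stable (c Fin.≟ i) λ c≢i →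
      1+n≢n (trans (HasRankN-unique Dep (rank⁅i,j⁆≡2 (c≢i ∘′ sym)) rank⁅i,c⁆≡k)
                   (HasRankN-unique Dep rank⁅i⁆≡k (rank⁅i⁆≡1 i)))
    from : c ≡ i → InClN Dep ⁅ i ⁆ c
    from refl = 1 , rank⁅i⁆≡1 i , subst (λ X → HasRankN Dep X 1) (sym (∪-idem ⁅ i ⁆)) (rank⁅i⁆≡1 i)

  δ-cl⁅i⁆≡⁅i⁆ : ∀ i → EqCl Dep ⁅ i ⁆ ⁅ i ⁆
  δ-cl⁅i⁆≡⁅i⁆ i c = mk⇔ (Equivalence.from (δ-cl⁅i⁆⇔≡ i c) ∘′ x∈⁅y⁆⇒x≡y i)
                       (λ c∈cl → subst (_∈ ⁅ i ⁆) (sym (Equivalence.to (δ-cl⁅i⁆⇔≡ i c) c∈cl)) (x∈⁅x⁆ i))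

  δ-flat⁅i⁆ : ∀ i → IsFlatN Dep ⁅ i ⁆
  δ-flat⁅i⁆ i c = Equivalence.from (δ-cl⁅i⁆≡⁅i⁆ i c)

  δ-atom⇒cl⁅i⁆ : ∀ X → HasRankN Dep X 1 → ∃[ i ] EqCl Dep X ⁅ i ⁆
  δ-atom⇒cl⁅i⁆ X rankX≡1@((I , I⊆X , I-indep , ∣I∣≡1) , maximal)
    with nonempty I (≤-reflexive (sym ∣I∣≡1))
  ... | i , i∈I = i , λ c → mk⇔ (to c) (λ c∈cl → subst (_∈ X) (sym (Equivalence.to (δ-cl⁅i⁆⇔≡ i c) c∈cl)) (I⊆X i∈I))
    where
    to : ∀ c → c ∈ X → InClN Dep ⁅ i ⁆ c
    to c c∈X = Equivalence.from (δ-cl⁅i⁆⇔≡ i c) (decidable-stable (c Fin.≟ i) λ c≢i →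
      contradiction (maximal (⁅ i ⁆ ∪ ⁅ c ⁆) (∪-least (x∈p⇒⁅x⁆⊆p (I⊆X i∈I)) (x∈p⇒⁅x⁆⊆p c∈X))
                      (InS⇒δ-independent _ (∣S∣≤2⇒InS (⁅ i ⁆ ∪ ⁅ c ⁆) (≤-reflexive (x≢y⇒∣⁅x⁆∪⁅y⁆∣≡2 (c≢i ∘′ sym))))))
                    (subst (λ k → ¬ k ≤ 1) (sym (x≢y⇒∣⁅x⁆∪⁅y⁆∣≡2 (c≢i ∘′ sym))) λ { (s≤s ()) }))

  circuitsAvoiding : Subset n → Subset m
  circuitsAvoiding F = subsetOf (λ i → F ⊆? H i)

  ∈circuitsAvoiding⁻ : i ∈ circuitsAvoiding F → F ⊆ H i
  ∈circuitsAvoiding⁻ {F = F} = ∈subsetOf⁻ (λ i → F ⊆? H i)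

  ∈circuitsAvoiding⁺ : F ⊆ H i → i ∈ circuitsAvoiding F
  ∈circuitsAvoiding⁺ {F = F} = ∈subsetOf⁺ (λ i → F ⊆? H i)

  circuitsAvoiding-H : ∀ i → circuitsAvoiding (H i) ≡ ⁅ i ⁆
  circuitsAvoiding-H i = ⊆-antisym
    (λ {j} j∈ → subst (_∈ ⁅ i ⁆) (H-⊆⇒≡ (∈circuitsAvoiding⁻ j∈)) (x∈⁅x⁆ i))
    (λ {j} j∈⁅i⁆ → ∈circuitsAvoiding⁺ (⊆-reflexive (cong H (sym (x∈⁅y⁆⇒x≡y i j∈⁅i⁆)))))

  circuitsAvoiding-order-embedding : M*.Flat F → (G ⊆ F ⇔ circuitsAvoiding F ⊆ circuitsAvoiding G)
  circuitsAvoiding-order-embedding {F} {G} flatF = mk⇔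
    (λ G⊆F {i} i∈ → ∈circuitsAvoiding⁺ {F = G} (λ x∈G → ∈circuitsAvoiding⁻ {F = F} i∈ (G⊆F x∈G)))
    from
    where
    from : circuitsAvoiding F ⊆ circuitsAvoiding G → G ⊆ F
    from fF⊆fG {x} x∈G = decidable-stable (x ∈? F) λ x∉F →
      let (i , F⊆Hi , x∈Ci) = flat⊆H-avoiding flatF x∉F
      in x∈p⇒x∉∁p x∈Ci (∈circuitsAvoiding⁻ (fF⊆fG (∈circuitsAvoiding⁺ F⊆Hi)) x∈G)

  InS⊆circuitsAvoiding⇒∣J∣+r*F≤3 : ∀ J → J ⊆ circuitsAvoiding F → InS M en J → ∣ J ∣ + r* F ≤ 3
  InS⊆circuitsAvoiding⇒∣J∣+r*F≤3 {F} J J⊆fF J∈𝒮 = ≤-trans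
    (+-monoʳ-≤ ∣ J ∣ (M*.mono (λ x∈F → ∈⋂H⁺ J (λ j∈J → ∈circuitsAvoiding⁻ (J⊆fF j∈J) x∈F))))
    (InS⇒∣S∣+r*≤3 J J∈𝒮)

  δ-empty-flat-rank : ∀ X → Empty X → IsFlatN Dep X × HasRankN Dep X 0
  δ-empty-flat-rank X emptyX = flat , rankX≡0
    where
    ∣J∣≡0 : ∀ J → J ⊆ X → ∣ J ∣ ≡ 0
    ∣J∣≡0 J J⊆X = trans (cong ∣_∣ (Empty-unique (λ (j , j∈J) → emptyX (j , J⊆X j∈J)))) (∣⊥∣≡0 m)
    rankX≡0 : HasRankN Dep X 0
    rankX≡0 = hasRank X 0 ⊥ (λ j∈⊥ → contradiction j∈⊥ ∉⊥) (∣S∣≤2⇒InS ⊥ (subst (_≤ 2) (sym (∣⊥∣≡0 m)) z≤n))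
      (∣⊥∣≡0 m) (λ J J⊆X _ → ≤-reflexive (∣J∣≡0 J J⊆X))
    flat : IsFlatN Dep X
    flat c (k , rankX≡k , rankXc≡k) = contradiction (begin
      1                    ≡⟨ ∣⁅x⁆∣≡1 c ⟨
      ∣ ⁅ c ⁆ ∣            ≤⟨ proj₂ rankXc≡k ⁅ c ⁆ (q⊆p∪q X ⁅ c ⁆) (InS⇒δ-independent ⁅ c ⁆ (InS⁅i⁆ c)) ⟩
      k                    ≡⟨ HasRankN-unique Dep rankX≡k rankX≡0 ⟩
      0                    ∎) λ ()
      where open ≤-Reasoning

  r*≡3⇒circuitsAvoiding-empty : r* F ≡ 3 → Empty (circuitsAvoiding F)
  r*≡3⇒circuitsAvoiding-empty {F} r*F≡3 (i , i∈fF) = contradiction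
    (≤-trans (≤-reflexive (sym r*F≡3)) (≤-trans (M*.mono (∈circuitsAvoiding⁻ i∈fF)) (≤-reflexive (r*H≡2 i))))
    λ { (s≤s (s≤s ())) }

  r*≡2⇒circuitsAvoiding≡⁅i⁆ : M*.Flat F → r* F ≡ 2 → ∃[ i ] circuitsAvoiding F ≡ ⁅ i ⁆
  r*≡2⇒circuitsAvoiding≡⁅i⁆ {F} flatF r*F≡2 with hyperplane⇒H (flatF , trans (cong suc r*F≡2) (sym corank≡3))
  ... | i , refl = i , circuitsAvoiding-H i

  r*≡1⇒⊆two-H : M*.Flat F → r* F ≡ 1 → ∃[ i ] ∃[ j ] (i ≢ j × F ⊆ H i × F ⊆ H j)
  r*≡1⇒⊆two-H {F} flatF r*F≡1 = two-H (M*.flat-⊆-two-hyperplanes flatF 2+r*F≡corank)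
    where
    2+r*F≡corank : suc (suc (r* F)) ≡ corank M
    2+r*F≡corank = trans (cong (suc ∘′ suc) r*F≡1) (sym corank≡3)
    two-H : ∃[ H₁ ] ∃[ H₂ ] (M*.Hyperplane H₁ × M*.Hyperplane H₂ × F ⊆ H₁ × F ⊆ H₂ × ∃[ x ] (x ∈ H₁ × x ∉ H₂)) →
            ∃[ i ] ∃[ j ] (i ≢ j × F ⊆ H i × F ⊆ H j)
    two-H (H₁ , H₂ , hypH₁ , hypH₂ , F⊆H₁ , F⊆H₂ , x , x∈H₁ , x∉H₂)
      with hyperplane⇒H {H₁} hypH₁ | hyperplane⇒H {H₂} hypH₂
    ... | i , Hi≡H₁ | j , Hj≡H₂ =
      i , j , i≢j , ⊆-trans F⊆H₁ (⊆-reflexive (sym Hi≡H₁)) , ⊆-trans F⊆H₂ (⊆-reflexive (sym Hj≡H₂))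
      where
      i≢j : i ≢ j
      i≢j refl = x∉H₂ (subst (x ∈_) (trans (sym Hi≡H₁) Hj≡H₂) x∈H₁)

  δ-point-rank : M*.Flat F → r* F ≡ 1 → HasRankN Dep (circuitsAvoiding F) 2
  δ-point-rank {F} flatF r*F≡1 = rank2 (r*≡1⇒⊆two-H {F} flatF r*F≡1)
    where
    rank2 : ∃[ i ] ∃[ j ] (i ≢ j × F ⊆ H i × F ⊆ H j) → HasRankN Dep (circuitsAvoiding F) 2
    rank2 (i , j , i≢j , F⊆Hi , F⊆Hj) = hasRank (circuitsAvoiding F) 2 (⁅ i ⁆ ∪ ⁅ j ⁆)
      (∪-least (x∈p⇒⁅x⁆⊆p (∈circuitsAvoiding⁺ {F = F} {i = i} F⊆Hi))
               (x∈p⇒⁅x⁆⊆p (∈circuitsAvoiding⁺ {F = F} {i = j} F⊆Hj)))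
      (∣S∣≤2⇒InS (⁅ i ⁆ ∪ ⁅ j ⁆) (≤-reflexive (x≢y⇒∣⁅x⁆∪⁅y⁆∣≡2 i≢j))) (x≢y⇒∣⁅x⁆∪⁅y⁆∣≡2 i≢j)
      (λ J J⊆fF J∈𝒮 → +-cancelʳ-≤ 1 ∣ J ∣ 2
        (subst (λ r → ∣ J ∣ + r ≤ 3) r*F≡1 (InS⊆circuitsAvoiding⇒∣J∣+r*F≤3 {F} J J⊆fF J∈𝒮)))

  δ-point-flat : M*.Flat F → r* F ≡ 1 → IsFlatN Dep (circuitsAvoiding F)
  δ-point-flat {F} flatF r*F≡1 c (k , rank≡k , rankc≡k) = flat (r*≡1⇒⊆two-H {F} flatF r*F≡1)
    where
    flat : ∃[ i ] ∃[ j ] (i ≢ j × F ⊆ H i × F ⊆ H j) → c ∈ circuitsAvoiding F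
    flat (i , j , i≢j , F⊆Hi , F⊆Hj) = decidable-stable (c ∈? circuitsAvoiding F) λ c∉fF →
      let (y , y∈Hi∩Hj , y∉Hc) = ⊈⇒∃∈∉ {p = H i ∩ H j} {q = H c} λ Hi∩Hj⊆Hc →
            c∉fF (∈circuitsAvoiding⁺ {F = F} {i = c} λ x∈F → Hi∩Hj⊆Hc (x∈p∩q⁺ (F⊆Hi x∈F , F⊆Hj x∈F)))
          (ijc∈𝒮 , ∣ijc∣≡3) = triple-InS {i} {j} {c} {y} i≢j
            (p∩q⊆p (H i) (H j) y∈Hi∩Hj) (p∩q⊆q (H i) (H j) y∈Hi∩Hj) (x∉∁p⇒x∈p y∉Hc)
      in contradiction (begin
        3                             ≡⟨ ∣ijc∣≡3 ⟨
        ∣ (⁅ i ⁆ ∪ ⁅ j ⁆) ∪ ⁅ c ⁆ ∣   ≤⟨ proj₂ rankc≡k ((⁅ i ⁆ ∪ ⁅ j ⁆) ∪ ⁅ c ⁆)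
                                           (∪-least (⊆-trans ij⊆fF (p⊆p∪q ⁅ c ⁆)) (q⊆p∪q (circuitsAvoiding F) ⁅ c ⁆))
                                           (InS⇒δ-independent ((⁅ i ⁆ ∪ ⁅ j ⁆) ∪ ⁅ c ⁆) ijc∈𝒮) ⟩
        k                             ≡⟨ HasRankN-unique Dep rank≡k (δ-point-rank {F} flatF r*F≡1) ⟩
        2                             ∎) λ { (s≤s (s≤s ())) }
      where
      open ≤-Reasoning
      ij⊆fF : ⁅ i ⁆ ∪ ⁅ j ⁆ ⊆ circuitsAvoiding F
      ij⊆fF = ∪-least (x∈p⇒⁅x⁆⊆p (∈circuitsAvoiding⁺ {F = F} {i = i} F⊆Hi))
                      (x∈p⇒⁅x⁆⊆p (∈circuitsAvoiding⁺ {F = F} {i = j} F⊆Hj))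

  r*≡0⇒circuitsAvoiding≡⊤ : r* F ≡ 0 → circuitsAvoiding F ≡ ⊤
  r*≡0⇒circuitsAvoiding≡⊤ {F} r*F≡0 = ⊆-antisym ⊆⊤ λ {i} _ → ∈circuitsAvoiding⁺ {F = F} {i = i} (F⊆H i)
    where
    F⊆H : ∀ i → F ⊆ H i
    F⊆H i {x} x∈F = decidable-stable (x ∈? H i) λ x∉Hi → contradiction (begin-strict
      2                            ≡⟨ r*H≡2 i ⟨
      r* (H i)                     <⟨ H-flat i x x∉Hi ⟩
      r* (H i ∪ ⁅ x ⁆)             ≤⟨ M*.rank-∪ (H i) ⁅ x ⁆ ⟩
      r* (H i) + r* ⁅ x ⁆          ≤⟨ +-mono-≤ (≤-reflexive (r*H≡2 i)) (M*.mono (x∈p⇒⁅x⁆⊆p x∈F)) ⟩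
      2 + r* F                     ≡⟨ cong (2 +_) r*F≡0 ⟩
      2 + 0                        ∎) (n≮n 2)
      where open ≤-Reasoning

  -- Take a non-loop y of M*, two hyperplanes through the point cl {y} and one avoiding y.
  ∃InS-triple : ∃[ T ] (InS M en T × ∣ T ∣ ≡ 3)
  ∃InS-triple = triple (M*.augment {⊥} (subst₂ _<_ (sym M*.rank-⊥) (sym corank≡3) (s≤s z≤n)))
    where
    triple : ∃[ y ] r* ⊥ < r* (⊥ ∪ ⁅ y ⁆) → ∃[ T ] (InS M en T × ∣ T ∣ ≡ 3)
    triple (y , r*⊥<r*y) =
      let (i , j , i≢j , Q⊆Hi , Q⊆Hj) = r*≡1⇒⊆two-H {Q} (M*.cl-flat (⊥ ∪ ⁅ y ⁆)) r*Q≡1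
          (k , _ , y∈Ck) = flat⊆H-avoiding {F = M*.cl ⊥} {x = y} (M*.cl-flat ⊥) y∉cl⊥
      in (⁅ i ⁆ ∪ ⁅ j ⁆) ∪ ⁅ k ⁆ , triple-InS {i} {j} {k} {y} i≢j (Q⊆Hi y∈Q) (Q⊆Hj y∈Q) y∈Ck
      where
      Q : Subset n
      Q = M*.cl (⊥ ∪ ⁅ y ⁆)
      r*Q≡1 : r* Q ≡ 1
      r*Q≡1 = trans (M*.rank-cl (⊥ ∪ ⁅ y ⁆))
        (≤-antisym (subst (λ r → r* (⊥ ∪ ⁅ y ⁆) ≤ suc r) M*.rank-⊥ (M*.rank-∪⁅⁆ ⊥ y))
                   (subst (_< r* (⊥ ∪ ⁅ y ⁆)) M*.rank-⊥ r*⊥<r*y))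
      y∈Q : y ∈ Q
      y∈Q = M*.⊆cl (⊥ ∪ ⁅ y ⁆) (q⊆p∪q ⊥ ⁅ y ⁆ (x∈⁅x⁆ y))
      y∉cl⊥ : y ∉ M*.cl ⊥
      y∉cl⊥ y∈cl⊥ = <⇒≱ r*⊥<r*y (M*.∈cl⁻ {A = ⊥} y∈cl⊥)

  δ-rank⊤≡3 : HasRankN Dep ⊤ 3
  δ-rank⊤≡3 = let (T , T∈𝒮 , ∣T∣≡3) = ∃InS-triple
              in hasRank ⊤ 3 T ⊆⊤ T∈𝒮 ∣T∣≡3 (λ J _ J∈𝒮 → InS⇒∣S∣≤3 J J∈𝒮)

  circuitsAvoiding-flat-rank : M*.Flat F →
    IsFlatN Dep (circuitsAvoiding F) × HasRankN Dep (circuitsAvoiding F) (3 ∸ r* F)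
  circuitsAvoiding-flat-rank {F} flatF = by-rank (r* F) refl
    where
    by-rank : ∀ k → r* F ≡ k → IsFlatN Dep (circuitsAvoiding F) × HasRankN Dep (circuitsAvoiding F) (3 ∸ k)
    by-rank 0 r*F≡0 = subst (λ X → IsFlatN Dep X × HasRankN Dep X 3) (sym (r*≡0⇒circuitsAvoiding≡⊤ {F} r*F≡0))
                        ((λ _ _ → ∈⊤) , δ-rank⊤≡3)
    by-rank 1 r*F≡1 = δ-point-flat {F} flatF r*F≡1 , δ-point-rank {F} flatF r*F≡1
    by-rank 2 r*F≡2 = let (i , fF≡⁅i⁆) = r*≡2⇒circuitsAvoiding≡⁅i⁆ {F} flatF r*F≡2
                      in subst (λ X → IsFlatN Dep X × HasRankN Dep X 1) (sym fF≡⁅i⁆) (δ-flat⁅i⁆ i , rank⁅i⁆≡1 i)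
    by-rank 3 r*F≡3 = δ-empty-flat-rank (circuitsAvoiding F) (r*≡3⇒circuitsAvoiding-empty {F} r*F≡3)
    by-rank (suc (suc (suc (suc k)))) r*F≡4+k =
      contradiction (subst (_≤ 3) r*F≡4+k (r*≤3 F)) λ { (s≤s (s≤s (s≤s ()))) }

theorem6p4 : ∀ {n} (M : Matroid n) → corank M ≡ 3 →
    ∀ {m} (en : CircuitEnumeration M m) →
    IsAdjoint M en (derivedDependent M en)
theorem6p4 M corank≡3 en =
    (λ i → ⁅ i ⁆ , δ-cl⁅i⁆≡⁅i⁆ i , δ-flat⁅i⁆ i , rank⁅i⁆≡1 i)
  , (λ i j same-closure → cong H (Equivalence.to (δ-cl⁅i⁆⇔≡ j i)
                                   (Equivalence.to (same-closure i) (Equivalence.from (δ-cl⁅i⁆⇔≡ i i) refl))))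
  , (λ X _ → δ-atom⇒cl⁅i⁆ X)
  , circuitsAvoiding
  , (λ i → subst (λ X → EqCl (derivedDependent M en) X ⁅ i ⁆) (sym (circuitsAvoiding-H i)) (δ-cl⁅i⁆≡⁅i⁆ i))
  , (λ F flatF → proj₁ (circuitsAvoiding-flat-rank {F = F} flatF))
  , (λ F G flatF _ → circuitsAvoiding-order-embedding {F = F} {G = G} flatF)
  , (λ F flatF → subst (λ c → HasRankN (derivedDependent M en) (circuitsAvoiding F) (c ∸ dualRank M F))
                       (sym corank≡3) (proj₂ (circuitsAvoiding-flat-rank {F = F} flatF)))
  where open CorankThree M corank≡3 en
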